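{- Let $F$ be a non-archimedean local field with residue field of order $q$, and $\mathcal{B}$ the Bruhat--Tits building of $\mathrm{PGL}_3(F)$. Let $(\tilde c_0,\ldots,\tilde c_n)$ be a type~1 tailless pointed chamber gallery in $\mathcal{B}$. Then there exist exactly $q$ distinct pointed chambers $\tilde c_{n+1}$ such that $(\tilde c_0,\ldots,\tilde c_n,\tilde c_{n+1})$ is again a type~1 tailless pointed chamber gallery.
   Context: Let $\nu$ be the valuation of $F$, $\mathcal{O}$ its valuation ring and $\pi$ a uniformizer. Vertices of $\mathcal{B}$ are homothety classes $[L]$ of rank-3 $\mathcal{O}$-lattices in $F^3$; three vertices form a chamber if they have representatives with $\pi L_1\subset L_3\subset L_2\subset L_1$. Vertex type: $\tau([L])=\nu(\det g)\bmod3$ where $L=g\mathcal{O}^3$. A pointed chamber is an ordered triple $(v_1,v_2,v_3)$ of the vertices of a chamber; it has type 1 if $\tau(v_2)-\tau(v_1)\equiv\tau(v_3)-\tau(v_2)\equiv1\pmod3$. A type 1 pointed chamber gallery is a sequence $(c_0,\dots,c_n)$, $c_i=(v_{1,i},v_{2,i},v_{3,i})$, of type 1 pointed chambers with $v_{1,i+1}=v_{2,i}$ and $v_{2,i+1}=v_{3,i}$ for all $i$; it is tailless if $v_{1,i}\neq v_{3,i+1}$ for all $i$. -}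

module Defs where

open import Level using (Level; _⊔_) renaming (suc to lsuc)
open import Algebra.Bundles using (CommutativeRing)
open import Data.Nat as ℕ using (ℕ)
open import Data.Integer as ℤ using (ℤ)
open import Data.Fin using (Fin; zero; suc; inject₁)
open import Data.Product using (Σ; ∃; _×_; _,_)
open import Relation.Nullary using (¬_)
open import Relation.Binary.PropositionalEquality using (_≡_)

data ℤ∞ : Set where
  fin : ℤ → ℤ∞
  ∞   : ℤ∞

infix 4 _≤∞_
data _≤∞_ : ℤ∞ → ℤ∞ → Set where
  fin≤fin : ∀ {a b} → a ℤ.≤ b → fin a ≤∞ fin b
  _≤∞∞    : ∀ x → x ≤∞ ∞

infixl 6 _+∞_
_+∞_ : ℤ∞ → ℤ∞ → ℤ∞
fin a +∞ fin b = fin (a ℤ.+ b)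
fin _ +∞ ∞     = ∞
∞     +∞ _     = ∞

record NALocalField (c ℓ : Level) (q : ℕ) : Set (lsuc (c ⊔ ℓ)) where
  field
    commRing : CommutativeRing c ℓ
  open CommutativeRing commRing public
  field
    0≉1     : ¬ (0# ≈ 1#)
    inverse : ∀ x → ¬ (x ≈ 0#) → ∃ λ y → x * y ≈ 1#
    ν       : Carrier → ℤ∞
    ν-cong  : ∀ {x y} → x ≈ y → ν x ≡ ν y
    ν-∞⇒0   : ∀ x → ν x ≡ ∞ → x ≈ 0#
    ν-0     : ν 0# ≡ ∞
    ν-*     : ∀ x y → ν (x * y) ≡ ν x +∞ ν y
    ν-+     : ∀ x y z → z ≤∞ ν x → z ≤∞ ν y → z ≤∞ ν (x + y)
    -- a uniformizer (so ν is normalized, i.e. surjective onto ℤ)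
    π       : Carrier
    ν-π     : ν π ≡ fin (ℤ.+ 1)
    complete : (s : ℕ → Carrier) →
      (∀ (m : ℤ) → ∃ λ N → ∀ i j → N ℕ.≤ i → N ℕ.≤ j → fin m ≤∞ ν (s i - s j)) →
      ∃ λ x → ∀ (m : ℤ) → ∃ λ N → ∀ i → N ℕ.≤ i → fin m ≤∞ ν (s i - x)
    -- residue field O/πO has exactly q elements, represented by res
    res       : Fin q → Carrier
    res-int   : ∀ i → fin (ℤ.+ 0) ≤∞ ν (res i)
    res-cover : ∀ x → fin (ℤ.+ 0) ≤∞ ν x → ∃ λ i → fin (ℤ.+ 1) ≤∞ ν (x - res i)
    res-inj   : ∀ i j → fin (ℤ.+ 1) ≤∞ ν (res i - res j) → i ≡ j

module Building {c ℓ : Level} {q : ℕ} (K : NALocalField c ℓ q) where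
  open NALocalField K using (Carrier; _≈_; _+_; _*_; _-_; 0#; 1#; ν; π)

  Vec3 : Set c
  Vec3 = Fin 3 → Carrier

  Mat3 : Set c
  Mat3 = Fin 3 → Fin 3 → Carrier

  sum3 : (Fin 3 → Carrier) → Carrier
  sum3 f = f zero + f (suc zero) + f (suc (suc zero))

  _·_ : Mat3 → Mat3 → Mat3
  (g · h) i k = sum3 (λ j → g i j * h j k)

  I3 : Mat3
  I3 zero zero = 1#
  I3 (suc (suc zero)) (suc (suc zero)) = 1#
  I3 (suc zero) (suc zero) = 1#
  I3 _ _ = 0#

  _≈M_ : Mat3 → Mat3 → Set ℓ
  g ≈M h = ∀ i j → g i j ≈ h i j

  det : Mat3 → Carrier
  det g = a * (e * i' - f * h) - b * (d * i' - f * gg) + c' * (d * h - e * gg)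
    where
      a  = g zero zero
      b  = g zero (suc zero)
      c' = g zero (suc (suc zero))
      d  = g (suc zero) zero
      e  = g (suc zero) (suc zero)
      f  = g (suc zero) (suc (suc zero))
      gg = g (suc (suc zero)) zero
      h  = g (suc (suc zero)) (suc zero)
      i' = g (suc (suc zero)) (suc (suc zero))

  record GL3 : Set (c ⊔ ℓ) where
    field
      mat   : Mat3
      inv   : Mat3
      invˡ  : (inv · mat) ≈M I3
      invʳ  : (mat · inv) ≈M I3
  open GL3 public

  -- the lattice L = g 𝒪³, given by its membership predicate
  _∈L_ : Vec3 → GL3 → Set (c ⊔ ℓ)
  v ∈L g = ∃ λ (x : Vec3) → (∀ j → fin (ℤ.+ 0) ≤∞ ν (x j)) ×
                             (∀ i → v i ≈ sum3 (λ j → mat g i j * x j))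

  _∈[_]_ : Vec3 → Carrier → GL3 → Set (c ⊔ ℓ)
  v ∈[ a ] g = ∃ λ w → w ∈L g × (∀ i → v i ≈ a * w i)

  Nonzero : Carrier → Set ℓ
  Nonzero a = ¬ (a ≈ 0#)

  Incl : Carrier → GL3 → Carrier → GL3 → Set (c ⊔ ℓ)
  Incl a g b h = ∀ v → v ∈[ a ] g → v ∈[ b ] h

  StrictIncl : Carrier → GL3 → Carrier → GL3 → Set (c ⊔ ℓ)
  StrictIncl a g b h = Incl a g b h × ¬ Incl b h a g

  -- lattices of a vertex are GL3 elements; equality of vertices is homothety
  Vertex : Set (c ⊔ ℓ)
  Vertex = GL3

  _~_ : Vertex → Vertex → Set (c ⊔ ℓ)
  g ~ h = ∃ λ a → Nonzero a × Incl 1# g a h × Incl a h 1# g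

  IsChamber : Vertex → Vertex → Vertex → Set (c ⊔ ℓ)
  IsChamber g₁ g₂ g₃ = ∃ λ a → ∃ λ b → ∃ λ d →
    Nonzero a × Nonzero b × Nonzero d ×
    StrictIncl (π * a) g₁ d g₃ × StrictIncl d g₃ b g₂ × StrictIncl b g₂ a g₁

  -- τ(L₂) - τ(L₁) ≡ 1 (mod 3), with τ([g 𝒪³]) = ν(det g) mod 3
  TypeStep : Vertex → Vertex → Set
  TypeStep g h = ∃ λ z → ∃ λ w → ∃ λ k →
    ν (det (mat g)) ≡ fin z × ν (det (mat h)) ≡ fin w × w ℤ.- z ≡ ℤ.+ 1 ℤ.+ ℤ.+ 3 ℤ.* k

  record PointedChamber : Set (c ⊔ ℓ) where
    field
      v₁ v₂ v₃ : Vertex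
      chamber  : IsChamber v₁ v₂ v₃
  open PointedChamber public

  _≃PC_ : PointedChamber → PointedChamber → Set (c ⊔ ℓ)
  x ≃PC y = (v₁ x ~ v₁ y) × (v₂ x ~ v₂ y) × (v₃ x ~ v₃ y)

  Type1 : PointedChamber → Set
  Type1 x = TypeStep (v₁ x) (v₂ x) × TypeStep (v₂ x) (v₃ x)

  IsT1TaillessGallery : (m : ℕ) → (Fin (ℕ.suc m) → PointedChamber) → Set (c ⊔ ℓ)
  IsT1TaillessGallery m cs =
    (∀ i → Type1 (cs i)) ×
    (∀ (i : Fin m) → v₁ (cs (suc i)) ~ v₂ (cs (inject₁ i))) ×
    (∀ (i : Fin m) → v₂ (cs (suc i)) ~ v₃ (cs (inject₁ i))) ×
    (∀ (i : Fin m) → ¬ (v₁ (cs (inject₁ i)) ~ v₃ (cs (suc i))))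

snoc : ∀ {a} {A : Set a} {n : ℕ} → (Fin (ℕ.suc n) → A) → A → Fin (ℕ.suc (ℕ.suc n)) → A
snoc {n = ℕ.zero}  f x zero          = f zero
snoc {n = ℕ.zero}  f x (suc zero)    = x
snoc {n = ℕ.suc n} f x zero          = f zero
snoc {n = ℕ.suc n} f x (suc i)       = snoc (λ j → f (suc j)) x i

module Submission where

-- A lattice s · g 𝒪³ is compared with another one through the matrix expressing its basis in the
-- other's: inclusion means that this matrix is integral, and the valuation of its determinant is
-- the difference of the covolumes vol, so strict inclusions raise vol and the representatives
-- πL₁ ⊊ L₃ ⊊ L₂ ⊊ L₁ of a chamber have consecutive covolumes.  A type 1 chamber continuing a
-- gallery that ends in (L₁, L₂, L₃) is (L₂, L₃, W) with πL₂ ⊊ W ⊊ L₃, i.e. a line W / πL₂ in the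
-- plane L₃ / πL₂ over the residue field, and tailless means W ≠ πL₁.  Reducing modulo π yields a
-- basis B of L₂ with L₃ = B(𝒪 ⊕ 𝒪 ⊕ π𝒪) and πL₁ = B(π𝒪 ⊕ 𝒪 ⊕ π𝒪); in it the q + 1 lines are
-- B · T r, for r running over representatives of the residue field, and B · Δ = πL₁.  So the
-- extensions are exactly the q chambers (L₂, L₃, B · T r), and they are distinct because the
-- entry (1, 0) of (T r′)⁻¹ T r is (r − r′) / π.

open import Defs
open import Level using (Level; _⊔_)
open import Algebra.Bundles using (CommutativeRing)
open import Data.Nat as ℕ using (ℕ; zero; suc)
open import Data.Fin using (Fin; zero; suc; fromℕ; inject₁)
open import Data.Fin.Relation.Unary.Top using (view; ‵fromℕ; ‵inject₁)
open import Data.Product using (Σ; ∃; _×_; _,_; proj₁; proj₂)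
open import Relation.Nullary using (¬_)
open import Relation.Binary.PropositionalEquality as P using (_≡_)

module _ {a} {A : Set a} where

  snoc-inject₁ : ∀ {n} (f : Fin (suc n) → A) x i → snoc f x (inject₁ i) ≡ f i
  snoc-inject₁ {zero}  f x zero    = P.refl
  snoc-inject₁ {suc n} f x zero    = P.refl
  snoc-inject₁ {suc n} f x (suc i) = snoc-inject₁ (λ j → f (suc j)) x i

  snoc-last : ∀ {n} (f : Fin (suc n) → A) x → snoc f x (fromℕ (suc n)) ≡ x
  snoc-last {zero}  f x = P.refl
  snoc-last {suc n} f x = snoc-last (λ j → f (suc j)) x

  snoc-all : ∀ {p} (Q : A → Set p) {n} (f : Fin (suc n) → A) x →
             (∀ i → Q (f i)) → Q x → ∀ i → Q (snoc f x i)
  snoc-all Q f x Qf Qx i with view i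
  ... | ‵fromℕ     = P.subst Q (P.sym (snoc-last f x)) Qx
  ... | ‵inject₁ j = P.subst Q (P.sym (snoc-inject₁ f x j)) (Qf j)

  module _ {r} (R : A → A → Set r) where

    snoc-adjacent : ∀ {n} (f : Fin (suc n) → A) x →
                    (∀ i → R (f (inject₁ i)) (f (suc i))) → R (f (fromℕ n)) x →
                    ∀ i → R (snoc f x (inject₁ i)) (snoc f x (suc i))
    snoc-adjacent f x Rf Rx i with view i
    ... | ‵fromℕ     = P.subst₂ R (P.sym (snoc-inject₁ f x _)) (P.sym (snoc-last f x)) Rx
    ... | ‵inject₁ j = P.subst₂ R (P.sym (snoc-inject₁ f x _)) (P.sym (snoc-inject₁ f x (suc j))) (Rf j)

    snoc-adjacent-last : ∀ {n} (f : Fin (suc n) → A) x →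
                         (∀ i → R (snoc f x (inject₁ i)) (snoc f x (suc i))) → R (f (fromℕ n)) x
    snoc-adjacent-last {n} f x R-snoc =
      P.subst₂ R (snoc-inject₁ f x (fromℕ n)) (snoc-last f x) (R-snoc (fromℕ n))


-- The standard-library ring solver needs coefficients with a decidable equality, and ℤ maps
-- into every commutative ring.  The optimised multiple _×′_ makes ⟦ + 1 ⟧ℤ definitionally 1#,
-- so that the solver's normal forms match goals stated with 1#.
module IntegerRingSolver {c ℓ} (R : CommutativeRing c ℓ) where

  open import Data.Integer as ℤ using (ℤ; +_; -[1+_]; _⊖_; _◃_)
  import Data.Integer.Properties as ℤP
  import Data.Nat.Properties as ℕP
  open import Data.Maybe using (Maybe; just; nothing)
  open import Relation.Nullary using (yes; no)
  open import Algebra.Solver.Ring.AlmostCommutativeRing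
  open CommutativeRing R
  open import Algebra.Properties.Semiring.Mult.TCOptimised semiring using (1+×; ×-homo-+; ×1-homo-*)
    renaming (_×_ to _×′_)
  open import Algebra.Properties.Ring ring using (-‿involutive; -1*x≈-x; -‿+-comm; -0#≈0#)
  open import Algebra.Properties.CommutativeSemigroup *-commutativeSemigroup using (interchange)
  open import Data.Sign as Sign using (Sign)
  open import Relation.Binary.Reasoning.Setoid setoid

  ⟦_⟧ℤ : ℤ → Carrier
  ⟦ + n ⟧ℤ    = n ×′ 1#
  ⟦ -[1+ n ] ⟧ℤ = - (suc n ×′ 1#)

  private
    1+x-[1+y]≈x-y : ∀ x y → (1# + x) - (1# + y) ≈ x - y
    1+x-[1+y]≈x-y x y = begin
      (1# + x) - (1# + y)   ≈⟨ +-congˡ (-‿+-comm 1# y) ⟨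
      (1# + x) + (- 1# - y) ≈⟨ +-assoc 1# x _ ⟩
      1# + (x + (- 1# - y)) ≈⟨ +-congˡ (trans (+-congˡ (+-comm _ _)) (sym (+-assoc _ _ _))) ⟩
      1# + ((x - y) - 1#)   ≈⟨ +-comm 1# _ ⟩
      ((x - y) - 1#) + 1#   ≈⟨ +-assoc _ _ _ ⟩
      (x - y) + (- 1# + 1#) ≈⟨ +-congˡ (-‿inverseˡ 1#) ⟩
      (x - y) + 0#          ≈⟨ +-identityʳ _ ⟩
      x - y                 ∎

  ⊖-homo : ∀ m n → ⟦ m ⊖ n ⟧ℤ ≈ m ×′ 1# - n ×′ 1#
  ⊖-homo zero    zero    = sym (-‿inverseʳ 0#)
  ⊖-homo (suc m) zero    = sym (trans (+-congˡ -0#≈0#) (+-identityʳ _))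
  ⊖-homo zero    (suc n) = sym (+-identityˡ _)
  ⊖-homo (suc m) (suc n) = begin
    ⟦ suc m ⊖ suc n ⟧ℤ           ≡⟨ P.cong ⟦_⟧ℤ (ℤP.[1+m]⊖[1+n]≡m⊖n m n) ⟩
    ⟦ m ⊖ n ⟧ℤ                   ≈⟨ ⊖-homo m n ⟩
    m ×′ 1# - n ×′ 1#             ≈⟨ 1+x-[1+y]≈x-y _ _ ⟨
    (1# + m ×′ 1#) - (1# + n ×′ 1#) ≈⟨ +-cong (1+× m 1#) (-‿cong (1+× n 1#)) ⟨
    suc m ×′ 1# - suc n ×′ 1#     ∎

  +-homo : ∀ i j → ⟦ i ℤ.+ j ⟧ℤ ≈ ⟦ i ⟧ℤ + ⟦ j ⟧ℤ
  +-homo (+ m)    (+ n)    = ×-homo-+ 1# m n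
  +-homo (+ m)    -[1+ n ] = ⊖-homo m (suc n)
  +-homo -[1+ m ] (+ n)    = trans (⊖-homo n (suc m)) (+-comm _ _)
  +-homo -[1+ m ] -[1+ n ] = begin
    - (suc (suc (m ℕ.+ n)) ×′ 1#)      ≡⟨ P.cong (λ k → - (k ×′ 1#)) (ℕP.+-suc (suc m) n) ⟨
    - ((suc m ℕ.+ suc n) ×′ 1#)        ≈⟨ -‿cong (×-homo-+ 1# (suc m) (suc n)) ⟩
    - (suc m ×′ 1# + suc n ×′ 1#)       ≈⟨ -‿+-comm _ _ ⟨
    - (suc m ×′ 1#) + - (suc n ×′ 1#)   ∎

  -‿homo : ∀ i → ⟦ ℤ.- i ⟧ℤ ≈ - ⟦ i ⟧ℤ
  -‿homo (+ zero)  = sym -0#≈0#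
  -‿homo (+ suc n) = refl
  -‿homo -[1+ n ]  = sym (-‿involutive _)

  ⟦_⟧± : Sign → Carrier
  ⟦ Sign.+ ⟧± = 1#
  ⟦ Sign.- ⟧± = - 1#

  ◃-homo : ∀ s n → ⟦ s ◃ n ⟧ℤ ≈ ⟦ s ⟧± * (n ×′ 1#)
  ◃-homo s      zero    = sym (zeroʳ _)
  ◃-homo Sign.+ (suc n) = sym (*-identityˡ _)
  ◃-homo Sign.- (suc n) = sym (-1*x≈-x _)

  sign-*-homo : ∀ s t → ⟦ s Sign.* t ⟧± ≈ ⟦ s ⟧± * ⟦ t ⟧±
  sign-*-homo Sign.+ t      = sym (*-identityˡ _)
  sign-*-homo Sign.- Sign.+ = sym (*-identityʳ _)
  sign-*-homo Sign.- Sign.- = sym (trans (-1*x≈-x (- 1#)) (-‿involutive 1#))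

  ⟦⟧ℤ≈sign*abs : ∀ i → ⟦ i ⟧ℤ ≈ ⟦ ℤ.sign i ⟧± * (ℤ.∣ i ∣ ×′ 1#)
  ⟦⟧ℤ≈sign*abs i = trans (reflexive (P.cong ⟦_⟧ℤ (P.sym (ℤP.◃-inverse i)))) (◃-homo (ℤ.sign i) ℤ.∣ i ∣)

  *-homo : ∀ i j → ⟦ i ℤ.* j ⟧ℤ ≈ ⟦ i ⟧ℤ * ⟦ j ⟧ℤ
  *-homo i j = begin
    ⟦ i ℤ.* j ⟧ℤ                                   ≈⟨ ◃-homo (si Sign.* sj) (m ℕ.* n) ⟩
    ⟦ si Sign.* sj ⟧± * ((m ℕ.* n) ×′ 1#)            ≈⟨ *-cong (sign-*-homo si sj) (×1-homo-* m n) ⟩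
    (⟦ si ⟧± * ⟦ sj ⟧±) * ((m ×′ 1#) * (n ×′ 1#))      ≈⟨ interchange _ _ _ _ ⟩
    (⟦ si ⟧± * (m ×′ 1#)) * (⟦ sj ⟧± * (n ×′ 1#))      ≈⟨ *-cong (⟦⟧ℤ≈sign*abs i) (⟦⟧ℤ≈sign*abs j) ⟨
    ⟦ i ⟧ℤ * ⟦ j ⟧ℤ                                ∎
    where
    si sj : Sign
    si = ℤ.sign i
    sj = ℤ.sign j
    m n : ℕ
    m = ℤ.∣ i ∣
    n = ℤ.∣ j ∣

  morphism : ℤ.+-*-rawRing -Raw-AlmostCommutative⟶ fromCommutativeRing R
  morphism = record
    { ⟦_⟧ = ⟦_⟧ℤ ; +-homo = +-homo ; *-homo = *-homo ; -‿homo = -‿homo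
    ; 0-homo = refl ; 1-homo = refl }

  equal-images? : ∀ i j → Maybe (⟦ i ⟧ℤ ≈ ⟦ j ⟧ℤ)
  equal-images? i j with i ℤ.≟ j
  ... | yes P.refl = just refl
  ... | no _       = nothing

  open import Algebra.Solver.Ring ℤ.+-*-rawRing (fromCommutativeRing R) morphism equal-images? public


module IntegerArithmetic where
  open import Algebra.Bundles using (AbelianGroup)
  open import Data.Integer as ℤ using (ℤ; +_; -1ℤ; _+_; _-_; _≤_; _<_)
  import Data.Nat.Properties as ℕP
  import Data.Integer.Properties as ℤP
  open import Data.Integer.Tactic.RingSolver using (solve-∀)
  open import Algebra.Properties.Group (AbelianGroup.group ℤP.+-0-abelianGroup) public
    using () renaming (∙-cancelˡ to +-cancelˡ-≡; ∙-cancelʳ to +-cancelʳ-≡; inverseʳ-unique to +-inverseʳ-unique)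

  3×-cancel : ∀ a b w → ((a + a) + a) + w ≡ ((b + b) + b) + w → a ≡ b
  3×-cancel a b w e = ℤP.*-cancelˡ-≡ (+ 3) a b (P.trans (3× a) (P.trans (+-cancelʳ-≡ w _ _ e) (P.sym (3× b))))
    where
    3× : ∀ x → + 3 ℤ.* x ≡ (x + x) + x
    3× = solve-∀

  x≡y+k⇒x-y≡k : ∀ {x y k} → x ≡ y + k → x - y ≡ k
  x≡y+k⇒x-y≡k {y = y} {k} P.refl = y+k-y≡k y k
    where
    y+k-y≡k : ∀ y k → (y + k) - y ≡ k
    y+k-y≡k = solve-∀

  x+k<x+1+k : ∀ x k → x + + k < x + + ℕ.suc k
  x+k<x+1+k x k = ℤP.+-monoʳ-< x (ℤ.+<+ (ℕP.n<1+n k))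

  consecutive : ∀ {x y z} → x < y → y < z → z < x + + 3 → (y ≡ x + + 1) × (z ≡ x + + 2)
  consecutive {x} {y} {z} x<y y<z z<x+3 =
    ℤP.≤-antisym (P.subst (y ≤_) (e₁ x) y≤x+3-2) (P.subst (_≤ y) (ℤP.+-comm (+ 1) x) 1+x≤y) ,
    ℤP.≤-antisym (P.subst (z ≤_) (e₂ x) z≤x+3-1) (P.subst (_≤ z) (e₃ x) (ℤP.≤-trans (ℤP.suc-mono 1+x≤y) (ℤP.i<j⇒suc[i]≤j y<z)))
    where
    e₁ : ∀ x → -1ℤ + (-1ℤ + (x + + 3)) ≡ x + + 1
    e₁ = solve-∀
    e₂ : ∀ x → -1ℤ + (x + + 3) ≡ x + + 2
    e₂ = solve-∀
    e₃ : ∀ x → + 1 + (+ 1 + x) ≡ x + + 2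
    e₃ = solve-∀
    1+x≤y : + 1 + x ≤ y
    1+x≤y = ℤP.i<j⇒suc[i]≤j x<y
    z≤x+3-1 : z ≤ -1ℤ + (x + + 3)
    z≤x+3-1 = ℤP.i<j⇒i≤pred[j] z<x+3
    y≤x+3-2 : y ≤ -1ℤ + (-1ℤ + (x + + 3))
    y≤x+3-2 = ℤP.i<j⇒i≤pred[j] (ℤP.<-≤-trans y<z z≤x+3-1)


module Valuation {c ℓ : Level} {q : ℕ} (K : NALocalField c ℓ q) where

  open import Data.Integer as ℤ using (ℤ; +_; -[1+_])
  import Data.Integer.Properties as ℤP
  open import Data.Empty using (⊥-elim)
  open import Relation.Nullary using (Dec; yes; no)
  open NALocalField K public hiding (zero)
  open Building K public using (Nonzero)
  open IntegerRingSolver commRing public using (solve; _:=_; _:+_; _:*_; _:-_; :-_; con)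
  open IntegerArithmetic using (+-cancelˡ-≡)

  fin-injective : ∀ {a b} → fin a ≡ fin b → a ≡ b
  fin-injective P.refl = P.refl

  ≤∞-trans : ∀ {x y z} → x ≤∞ y → y ≤∞ z → x ≤∞ z
  ≤∞-trans (fin≤fin a) (fin≤fin b) = fin≤fin (ℤP.≤-trans a b)
  ≤∞-trans _           (_ ≤∞∞)     = _ ≤∞∞

  +∞-mono : ∀ {a b x y} → fin a ≤∞ x → fin b ≤∞ y → fin (a ℤ.+ b) ≤∞ (x +∞ y)
  +∞-mono (fin≤fin p) (fin≤fin p′) = fin≤fin (ℤP.+-mono-≤ p p′)
  +∞-mono (fin≤fin p) (_ ≤∞∞)      = _ ≤∞∞
  +∞-mono (_ ≤∞∞)     _            = _ ≤∞∞

  1≉0 : ¬ 1# ≈ 0#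
  1≉0 e = 0≉1 (sym e)

  -- val 0# is the junk value + 0.
  val : Carrier → ℤ
  val x with ν x
  ... | fin z = z
  ... | ∞     = + 0

  ν≡fin-val : ∀ {x} → Nonzero x → ν x ≡ fin (val x)
  ν≡fin-val {x} x≉0 with ν x in eq
  ... | fin z = P.refl
  ... | ∞     = ⊥-elim (x≉0 (ν-∞⇒0 x eq))

  val-cong : ∀ {x y} → x ≈ y → val x ≡ val y
  val-cong {x} {y} e with ν x | ν y | ν-cong e
  ... | fin a | fin .a | P.refl = P.refl
  ... | ∞     | ∞      | P.refl = P.refl

  Nonzero-* : ∀ {x y} → Nonzero x → Nonzero y → Nonzero (x * y)
  Nonzero-* {x} {y} x≉0 y≉0 xy≈0 with P.trans (P.sym (ν-* x y)) (P.trans (ν-cong xy≈0) ν-0)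
  ... | νx+νy≡∞ rewrite ν≡fin-val x≉0 | ν≡fin-val y≉0 with νx+νy≡∞
  ... | ()

  val-* : ∀ {x y} → Nonzero x → Nonzero y → val (x * y) ≡ val x ℤ.+ val y
  val-* {x} {y} x≉0 y≉0 = fin-injective (begin
    fin (val (x * y))        ≡⟨ ν≡fin-val (Nonzero-* x≉0 y≉0) ⟨
    ν (x * y)                ≡⟨ ν-* x y ⟩
    ν x +∞ ν y               ≡⟨ P.cong₂ _+∞_ (ν≡fin-val x≉0) (ν≡fin-val y≉0) ⟩
    fin (val x ℤ.+ val y)    ∎)
    where open P.≡-Reasoning

  val-1# : val 1# ≡ + 0
  val-1# = P.sym (+-cancelˡ-≡ (val 1#) (+ 0) (val 1#) (begin
    val 1# ℤ.+ + 0     ≡⟨ ℤP.+-identityʳ _ ⟩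
    val 1#             ≡⟨ val-cong (*-identityʳ 1#) ⟨
    val (1# * 1#)      ≡⟨ val-* 1≉0 1≉0 ⟩
    val 1# ℤ.+ val 1#  ∎))
    where open P.≡-Reasoning

  ν-1# : ν 1# ≡ fin (+ 0)
  ν-1# = P.trans (ν≡fin-val 1≉0) (P.cong fin val-1#)

  ν-neg : ∀ x → ν (- x) ≡ ν x
  ν-neg x = begin
    ν (- x)             ≡⟨ ν-cong (solve 1 (λ x → :- x := (:- con (+ 1)) :* x) refl x) ⟩
    ν (- 1# * x)        ≡⟨ ν-* (- 1#) x ⟩
    ν (- 1#) +∞ ν x     ≡⟨ P.cong (_+∞ ν x) (P.trans (ν≡fin-val -1≉0) (P.cong fin val-[-1]≡0)) ⟩
    fin (+ 0) +∞ ν x    ≡⟨ 0+∞ (ν x) ⟩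
    ν x                 ∎
    where
    open P.≡-Reasoning
    -1≉0 : Nonzero (- 1#)
    -1≉0 e = 1≉0 (trans (solve 0 (con (+ 1) := :- (:- con (+ 1))) refl)
                        (trans (-‿cong e) (solve 0 (:- con (+ 0) := con (+ 0)) refl)))
    z+z≡0⇒z≡0 : ∀ z → z ℤ.+ z ≡ + 0 → z ≡ + 0
    z+z≡0⇒z≡0 (+ 0)       _  = P.refl
    z+z≡0⇒z≡0 (+ ℕ.suc _) ()
    z+z≡0⇒z≡0 -[1+ _ ]    ()
    val-[-1]≡0 : val (- 1#) ≡ + 0
    val-[-1]≡0 = z+z≡0⇒z≡0 _ (P.trans (P.sym (val-* -1≉0 -1≉0))
                   (P.trans (val-cong (solve 0 ((:- con (+ 1)) :* (:- con (+ 1)) := con (+ 1)) refl)) val-1#))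
    0+∞ : ∀ w → fin (+ 0) +∞ w ≡ w
    0+∞ (fin z) = P.cong fin (ℤP.+-identityˡ z)
    0+∞ ∞       = P.refl

  infix 4 _≤ν_
  _≤ν_ : ℤ → Carrier → Set
  z ≤ν x = fin z ≤∞ ν x

  ≤ν-cong : ∀ {z x y} → x ≈ y → z ≤ν x → z ≤ν y
  ≤ν-cong {z} x≈y = P.subst (fin z ≤∞_) (ν-cong x≈y)

  ≤ν-reindex : ∀ {z z′ x} → z ≡ z′ → z ≤ν x → z′ ≤ν x
  ≤ν-reindex P.refl h = h

  ≤ν-weaken : ∀ {z z′ x} → z′ ℤ.≤ z → z ≤ν x → z′ ≤ν x
  ≤ν-weaken z′≤z = ≤∞-trans (fin≤fin z′≤z)

  ≤ν-exact : ∀ {z x} → ν x ≡ fin z → z ≤ν x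
  ≤ν-exact e = P.subst (fin _ ≤∞_) (P.sym e) (fin≤fin ℤP.≤-refl)

  ≤ν-val : ∀ {x} → Nonzero x → val x ≤ν x
  ≤ν-val x≉0 = ≤ν-exact (ν≡fin-val x≉0)

  ≤ν⇒≤val : ∀ {z x} → Nonzero x → z ≤ν x → z ℤ.≤ val x
  ≤ν⇒≤val {z} x≉0 h with P.subst (fin z ≤∞_) (ν≡fin-val x≉0) h
  ... | fin≤fin p = p

  ≤ν-0# : ∀ {z} → z ≤ν 0#
  ≤ν-0# {z} = P.subst (fin z ≤∞_) (P.sym ν-0) (_ ≤∞∞)

  ≤ν-1# : + 0 ≤ν 1#
  ≤ν-1# = ≤ν-exact ν-1#

  ≤ν-+ : ∀ {z x y} → z ≤ν x → z ≤ν y → z ≤ν x + y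
  ≤ν-+ {z} {x} {y} = ν-+ x y (fin z)

  ≤ν-* : ∀ {a b x y} → a ≤ν x → b ≤ν y → a ℤ.+ b ≤ν x * y
  ≤ν-* {a} {b} {x} {y} hx hy = P.subst (fin (a ℤ.+ b) ≤∞_) (P.sym (ν-* x y)) (+∞-mono hx hy)

  ≤ν-neg : ∀ {z x} → z ≤ν x → z ≤ν - x
  ≤ν-neg {z} {x} = P.subst (fin z ≤∞_) (P.sym (ν-neg x))

  ≤ν-- : ∀ {z x y} → z ≤ν x → z ≤ν y → z ≤ν x - y
  ≤ν-- hx hy = ≤ν-+ hx (≤ν-neg hy)

  Unit : Carrier → Set
  Unit x = ν x ≡ fin (+ 0)

  Unit? : ∀ x → Dec (Unit x)
  Unit? x with ν x
  ... | ∞     = no λ ()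
  ... | fin w with w ℤ.≟ + 0
  ... | yes P.refl = yes P.refl
  ... | no w≢0     = no λ e → w≢0 (fin-injective e)

  0≤ν∧¬Unit⇒1≤ν : ∀ {x} → + 0 ≤ν x → ¬ Unit x → + 1 ≤ν x
  0≤ν∧¬Unit⇒1≤ν {x} h ¬unit with ν x
  ... | ∞ = _ ≤∞∞
  0≤ν∧¬Unit⇒1≤ν {x} (fin≤fin (ℤ.+≤+ {n = 0} _))       ¬unit | fin .(+ 0)       = ⊥-elim (¬unit P.refl)
  0≤ν∧¬Unit⇒1≤ν {x} (fin≤fin (ℤ.+≤+ {n = ℕ.suc n} _)) ¬unit | fin .(+ ℕ.suc n) = fin≤fin (ℤ.+≤+ (ℕ.s≤s ℕ.z≤n))

  record Inv (x : Carrier) : Set (c ⊔ ℓ) where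
    field
      x⁻¹   : Carrier
      x*x⁻¹ : x * x⁻¹ ≈ 1#

  mkInv : ∀ x → Nonzero x → Inv x
  mkInv x x≉0 = record { x⁻¹ = proj₁ (inverse x x≉0) ; x*x⁻¹ = proj₂ (inverse x x≉0) }

  Inv⇒Nonzero : ∀ {x} → Inv x → Nonzero x
  Inv⇒Nonzero {x} i x≈0 = 0≉1 (trans (sym (zeroˡ (Inv.x⁻¹ i))) (trans (*-congʳ (sym x≈0)) (Inv.x*x⁻¹ i)))

  val-inv : ∀ {x} (i : Inv x) → val (Inv.x⁻¹ i) ≡ ℤ.- val x
  val-inv {x} i = IntegerArithmetic.+-inverseʳ-unique (val x) _ (begin
    val x ℤ.+ val (Inv.x⁻¹ i)   ≡⟨ val-* (Inv⇒Nonzero i) x⁻¹≉0 ⟨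
    val (x * Inv.x⁻¹ i)         ≡⟨ val-cong (Inv.x*x⁻¹ i) ⟩
    val 1#                      ≡⟨ val-1# ⟩
    + 0                         ∎)
    where
    open P.≡-Reasoning
    x⁻¹≉0 : Nonzero (Inv.x⁻¹ i)
    x⁻¹≉0 e = 0≉1 (trans (sym (zeroʳ x)) (trans (*-congˡ (sym e)) (Inv.x*x⁻¹ i)))


  Inv-* : ∀ {x y} → Inv x → Inv y → Inv (x * y)
  Inv-* {x} {y} i j = record
    { x⁻¹   = Inv.x⁻¹ i * Inv.x⁻¹ j
    ; x*x⁻¹ = trans (solve 4 (λ a b c d → (a :* b) :* (c :* d) := (a :* c) :* (b :* d)) refl x y _ _)
                    (trans (*-cong (Inv.x*x⁻¹ i) (Inv.x*x⁻¹ j)) (*-identityˡ 1#))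
    }

  Inv-inv : ∀ {x} (i : Inv x) → Inv (Inv.x⁻¹ i)
  Inv-inv {x} i = record { x⁻¹ = x ; x*x⁻¹ = trans (*-comm _ _) (Inv.x*x⁻¹ i) }

  Inv-cong : ∀ {x y} → x ≈ y → Inv x → Inv y
  Inv-cong e i = record { x⁻¹ = Inv.x⁻¹ i ; x*x⁻¹ = trans (*-congʳ (sym e)) (Inv.x*x⁻¹ i) }

  Inv-1# : Inv 1#
  Inv-1# = record { x⁻¹ = 1# ; x*x⁻¹ = *-identityˡ 1# }

  val-*-Inv : ∀ {x y} → Inv x → Inv y → val (x * y) ≡ val x ℤ.+ val y
  val-*-Inv i j = val-* (Inv⇒Nonzero i) (Inv⇒Nonzero j)

  ≤ν-inv : ∀ {x} (i : Inv x) → ℤ.- val x ≤ν Inv.x⁻¹ i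
  ≤ν-inv {x} i = P.subst (_≤ν Inv.x⁻¹ i) (val-inv i) (≤ν-val (Inv⇒Nonzero (Inv-inv i)))

  Unit⇒Nonzero : ∀ {x} → Unit x → Nonzero x
  Unit⇒Nonzero u x≈0 with P.trans (P.sym u) (P.trans (ν-cong x≈0) ν-0)
  ... | ()

  Unit⇒Inv : ∀ {x} → Unit x → Inv x
  Unit⇒Inv {x} u = mkInv x (Unit⇒Nonzero u)

  Unit⇒val≡0 : ∀ {x} → Unit x → val x ≡ + 0
  Unit⇒val≡0 u = fin-injective (P.trans (P.sym (ν≡fin-val (Unit⇒Nonzero u))) u)

  val≡0⇒Unit : ∀ {x} → Nonzero x → val x ≡ + 0 → Unit x
  val≡0⇒Unit x≉0 e = P.trans (ν≡fin-val x≉0) (P.cong fin e)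

  ≤ν-unit⁻¹ : ∀ {x} (u : Unit x) → + 0 ≤ν Inv.x⁻¹ (Unit⇒Inv u)
  ≤ν-unit⁻¹ u = P.subst (λ z → ℤ.- z ≤ν Inv.x⁻¹ (Unit⇒Inv u)) (Unit⇒val≡0 u) (≤ν-inv (Unit⇒Inv u))

  ≤ν-unit-cancel : ∀ {z u x} (h : Unit u) → z ≤ν u * x → z ≤ν x
  ≤ν-unit-cancel {z} {u} {x} h z≤νux = ≤ν-cong u⁻¹ux≈x (P.subst (_≤ν _) (ℤP.+-identityˡ z) (≤ν-* (≤ν-unit⁻¹ h) z≤νux))
    where
    u⁻¹ux≈x : Inv.x⁻¹ (Unit⇒Inv h) * (u * x) ≈ x
    u⁻¹ux≈x = trans (solve 3 (λ a b c → a :* (b :* c) := (b :* a) :* c) refl _ u x)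
                    (trans (*-congʳ (Inv.x*x⁻¹ (Unit⇒Inv h))) (*-identityˡ x))

  π≉0 : Nonzero π
  π≉0 π≈0 with P.trans (P.sym ν-π) (P.trans (ν-cong π≈0) ν-0)
  ... | ()

  π-Inv : Inv π
  π-Inv = mkInv π π≉0

  π⁻¹ : Carrier
  π⁻¹ = Inv.x⁻¹ π-Inv

  π*π⁻¹≈1 : π * π⁻¹ ≈ 1#
  π*π⁻¹≈1 = Inv.x*x⁻¹ π-Inv

  val-π : val π ≡ + 1
  val-π = fin-injective (P.trans (P.sym (ν≡fin-val π≉0)) ν-π)

  ≤ν-π : + 1 ≤ν π
  ≤ν-π = ≤ν-exact ν-π

  ≤ν-π⁻¹ : -[1+ 0 ] ≤ν π⁻¹
  ≤ν-π⁻¹ = P.subst (λ z → ℤ.- z ≤ν π⁻¹) val-π (≤ν-inv π-Inv)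

  ≤ν-π⁻¹* : ∀ {x} → + 1 ≤ν x → + 0 ≤ν π⁻¹ * x
  ≤ν-π⁻¹* = ≤ν-* ≤ν-π⁻¹


module Matrices {c ℓ : Level} {q : ℕ} (K : NALocalField c ℓ q) where

  open import Data.Integer as ℤ using (ℤ; +_; -[1+_])
  open import Relation.Binary.Bundles using (Setoid)
  import Relation.Binary.Reasoning.Setoid
  open import Data.Fin.Properties using (any?)
  open import Data.Sum using (_⊎_; inj₁; inj₂)
  open import Relation.Nullary using (yes; no)
  open Valuation K public
  open import Relation.Binary.Reasoning.Setoid setoid public
  open Building K public hiding (Nonzero)

  f0 f1 f2 : Fin 3
  f0 = zero

  f1 = suc zero

  f2 = suc (suc zero)

  col : Mat3 → Fin 3 → Vec3
  col A j i = A i j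

  cross : Vec3 → Vec3 → Vec3
  cross u v zero = u f1 * v f2 - u f2 * v f1
  cross u v (suc zero) = u f2 * v f0 - u f0 * v f2
  cross u v (suc (suc zero)) = u f0 * v f1 - u f1 * v f0

  dot : Vec3 → Vec3 → Carrier
  dot u v = sum3 (λ i → u i * v i)

  triple : Vec3 → Vec3 → Vec3 → Carrier
  triple u v w = dot (cross u v) w

  adj : Mat3 → Mat3
  adj A zero = cross (col A f1) (col A f2)
  adj A (suc zero) = cross (col A f2) (col A f0)
  adj A (suc (suc zero)) = cross (col A f0) (col A f1)

  mv : Mat3 → Vec3 → Vec3
  mv A x i = sum3 (λ j → A i j * x j)

  scal : Carrier → Mat3 → Mat3
  scal a A i j = a * A i j

  Integral : Mat3 → Set
  Integral A = ∀ i j → + 0 ≤ν A i j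

  IntegralV : Vec3 → Set
  IntegralV x = ∀ i → + 0 ≤ν x i

  _≈V_ : Vec3 → Vec3 → Set ℓ

  u ≈V v = ∀ i → u i ≈ v i

  infix 4 _≈V_

  ≈M-refl : ∀ {A} → A ≈M A
  ≈M-refl i j = refl

  ≈M-sym : ∀ {A B} → A ≈M B → B ≈M A
  ≈M-sym e i j = sym (e i j)

  ≈M-trans : ∀ {A B C} → A ≈M B → B ≈M C → A ≈M C
  ≈M-trans e f i j = trans (e i j) (f i j)

  MSetoid : Setoid c ℓ
  MSetoid = record
    { Carrier = Mat3 ; _≈_ = _≈M_
    ; isEquivalence = record { refl = λ {A} → ≈M-refl {A} ; sym = λ {A} {B} → ≈M-sym {A} {B} ; trans = λ {A} {B} {C} → ≈M-trans {A} {B} {C} }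
    }

  module MR = Relation.Binary.Reasoning.Setoid MSetoid

  ·-assoc : ∀ A B C → ((A · B) · C) ≈M (A · (B · C))
  ·-assoc A B C i j = solve 15 (λ a0 a1 a2 b00 b01 b02 b10 b11 b12 b20 b21 b22 c0 c1 c2 →
    (a0 :* b00 :+ a1 :* b10 :+ a2 :* b20) :* c0 :+ (a0 :* b01 :+ a1 :* b11 :+ a2 :* b21) :* c1 :+ (a0 :* b02 :+ a1 :* b12 :+ a2 :* b22) :* c2
    := a0 :* (b00 :* c0 :+ b01 :* c1 :+ b02 :* c2) :+ a1 :* (b10 :* c0 :+ b11 :* c1 :+ b12 :* c2) :+ a2 :* (b20 :* c0 :+ b21 :* c1 :+ b22 :* c2)) refl
    (A i f0) (A i f1) (A i f2) (B f0 f0) (B f0 f1) (B f0 f2) (B f1 f0) (B f1 f1) (B f1 f2) (B f2 f0) (B f2 f1) (B f2 f2) (C f0 j) (C f1 j) (C f2 j)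

  ·-cong : ∀ {A A' B B'} → A ≈M A' → B ≈M B' → (A · B) ≈M (A' · B')
  ·-cong e f i j = +-cong (+-cong (*-cong (e i f0) (f f0 j)) (*-cong (e i f1) (f f1 j))) (*-cong (e i f2) (f f2 j))

  ·-congˡ : ∀ A {B B'} → B ≈M B' → (A · B) ≈M (A · B')
  ·-congˡ A e = ·-cong (≈M-refl {A}) e

  ·-congʳ : ∀ {A A'} B → A ≈M A' → (A · B) ≈M (A' · B)
  ·-congʳ B e = ·-cong e (≈M-refl {B})

  ·-I : ∀ A → (A · I3) ≈M A
  ·-I A i zero = solve 3 (λ a b c →
      a :* con (+ 1) :+ b :* con (+ 0) :+ c :* con (+ 0)
      := a) refl (A i f0) (A i f1) (A i f2)
  ·-I A i (suc zero) = solve 3 (λ a b c →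
      a :* con (+ 0) :+ b :* con (+ 1) :+ c :* con (+ 0)
      := b) refl (A i f0) (A i f1) (A i f2)
  ·-I A i (suc (suc zero)) = solve 3 (λ a b c →
      a :* con (+ 0) :+ b :* con (+ 0) :+ c :* con (+ 1)
      := c) refl (A i f0) (A i f1) (A i f2)

  I-· : ∀ A → (I3 · A) ≈M A
  I-· A zero j = solve 3 (λ a b c →
      con (+ 1) :* a :+ con (+ 0) :* b :+ con (+ 0) :* c
      := a) refl (A f0 j) (A f1 j) (A f2 j)
  I-· A (suc zero) j = solve 3 (λ a b c →
      con (+ 0) :* a :+ con (+ 1) :* b :+ con (+ 0) :* c
      := b) refl (A f0 j) (A f1 j) (A f2 j)
  I-· A (suc (suc zero)) j = solve 3 (λ a b c →
      con (+ 0) :* a :+ con (+ 0) :* b :+ con (+ 1) :* c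
      := c) refl (A f0 j) (A f1 j) (A f2 j)

  scal-· : ∀ a A B → (scal a A · B) ≈M scal a (A · B)
  scal-· a A B i j = solve 7 (λ a x0 x1 x2 y0 y1 y2 →
      a :* x0 :* y0 :+ a :* x1 :* y1 :+ a :* x2 :* y2
      := a :* (x0 :* y0 :+ x1 :* y1 :+ x2 :* y2)) refl a (A i f0) (A i f1) (A i f2) (B f0 j) (B f1 j) (B f2 j)

  ·-scal : ∀ a A B → (A · scal a B) ≈M scal a (A · B)
  ·-scal a A B i j = solve 7 (λ a x0 x1 x2 y0 y1 y2 →
      x0 :* (a :* y0) :+ x1 :* (a :* y1) :+ x2 :* (a :* y2)
      := a :* (x0 :* y0 :+ x1 :* y1 :+ x2 :* y2)) refl a (A i f0) (A i f1) (A i f2) (B f0 j) (B f1 j) (B f2 j)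

  scal-scal : ∀ a b A → scal a (scal b A) ≈M scal (a * b) A
  scal-scal a b A i j = sym (*-assoc a b (A i j))

  scal-cong : ∀ {a b A B} → a ≈ b → A ≈M B → scal a A ≈M scal b B
  scal-cong e f i j = *-cong e (f i j)

  scal-congʳ : ∀ a {A B} → A ≈M B → scal a A ≈M scal a B
  scal-congʳ a e = scal-cong (refl {a}) e

  scal-congˡ : ∀ {a b} A → a ≈ b → scal a A ≈M scal b A
  scal-congˡ A e = scal-cong e (≈M-refl {A})

  scal-1 : ∀ A → scal 1# A ≈M A
  scal-1 A i j = *-identityˡ _

  mv-· : ∀ A B x → mv (A · B) x ≈V mv A (mv B x)
  mv-· A B x i = solve 15 (λ a0 a1 a2 b00 b01 b02 b10 b11 b12 b20 b21 b22 c0 c1 c2 →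
    (a0 :* b00 :+ a1 :* b10 :+ a2 :* b20) :* c0 :+ (a0 :* b01 :+ a1 :* b11 :+ a2 :* b21) :* c1 :+ (a0 :* b02 :+ a1 :* b12 :+ a2 :* b22) :* c2
    := a0 :* (b00 :* c0 :+ b01 :* c1 :+ b02 :* c2) :+ a1 :* (b10 :* c0 :+ b11 :* c1 :+ b12 :* c2) :+ a2 :* (b20 :* c0 :+ b21 :* c1 :+ b22 :* c2)) refl
    (A i f0) (A i f1) (A i f2) (B f0 f0) (B f0 f1) (B f0 f2) (B f1 f0) (B f1 f1) (B f1 f2) (B f2 f0) (B f2 f1) (B f2 f2) (x f0) (x f1) (x f2)

  mv-cong : ∀ {A B x y} → A ≈M B → x ≈V y → mv A x ≈V mv B y
  mv-cong e f i = +-cong (+-cong (*-cong (e i f0) (f f0)) (*-cong (e i f1) (f f1))) (*-cong (e i f2) (f f2))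

  mv-congˡ : ∀ {A B} x → A ≈M B → mv A x ≈V mv B x
  mv-congˡ x e = mv-cong e (λ i → refl {x i})

  mv-congʳ : ∀ A {x y} → x ≈V y → mv A x ≈V mv A y
  mv-congʳ A e = mv-cong (≈M-refl {A}) e

  mv-scal : ∀ a A x → mv (scal a A) x ≈V (λ i → a * mv A x i)
  mv-scal a A x i = solve 7 (λ a x0 x1 x2 y0 y1 y2 →
      a :* x0 :* y0 :+ a :* x1 :* y1 :+ a :* x2 :* y2
      := a :* (x0 :* y0 :+ x1 :* y1 :+ x2 :* y2)) refl a (A i f0) (A i f1) (A i f2) (x f0) (x f1) (x f2)

  mv-scalʳ : ∀ A c x → mv A (λ k → c * x k) ≈V (λ i → c * mv A x i)
  mv-scalʳ A c x i = solve 7 (λ c a0 a1 a2 x0 x1 x2 →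
      a0 :* (c :* x0) :+ a1 :* (c :* x1) :+ a2 :* (c :* x2)
      := c :* (a0 :* x0 :+ a1 :* x1 :+ a2 :* x2)) refl c (A i f0) (A i f1) (A i f2) (x f0) (x f1) (x f2)

  mv-I : ∀ x → mv I3 x ≈V x
  mv-I x zero = solve 3 (λ a b c →
      con (+ 1) :* a :+ con (+ 0) :* b :+ con (+ 0) :* c
      := a) refl (x f0) (x f1) (x f2)
  mv-I x (suc zero) = solve 3 (λ a b c →
      con (+ 0) :* a :+ con (+ 1) :* b :+ con (+ 0) :* c
      := b) refl (x f0) (x f1) (x f2)
  mv-I x (suc (suc zero)) = solve 3 (λ a b c →
      con (+ 0) :* a :+ con (+ 0) :* b :+ con (+ 1) :* c
      := c) refl (x f0) (x f1) (x f2)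

  cross-cong : ∀ {u u' v v'} → u ≈V u' → v ≈V v' → cross u v ≈V cross u' v'
  cross-cong eu ev zero = +-cong (*-cong (eu f1) (ev f2)) (-‿cong (*-cong (eu f2) (ev f1)))
  cross-cong eu ev (suc zero) = +-cong (*-cong (eu f2) (ev f0)) (-‿cong (*-cong (eu f0) (ev f2)))
  cross-cong eu ev (suc (suc zero)) = +-cong (*-cong (eu f0) (ev f1)) (-‿cong (*-cong (eu f1) (ev f0)))

  dot-cong : ∀ {u u' v v'} → u ≈V u' → v ≈V v' → dot u v ≈ dot u' v'
  dot-cong eu ev = +-cong (+-cong (*-cong (eu f0) (ev f0)) (*-cong (eu f1) (ev f1))) (*-cong (eu f2) (ev f2))

  triple-cong : ∀ {u u' v v' w w'} → u ≈V u' → v ≈V v' → w ≈V w' → triple u v w ≈ triple u' v' w'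
  triple-cong eu ev ew = dot-cong (cross-cong eu ev) ew

  cross-anti : ∀ u v i → cross v u i ≈ - cross u v i
  cross-anti u v zero = solve 4 (λ a b c d →
      c :* b :- d :* a
      := :- (a :* d :- b :* c)) refl (u f1) (u f2) (v f1) (v f2)
  cross-anti u v (suc zero) = solve 4 (λ a b c d →
      c :* b :- d :* a
      := :- (a :* d :- b :* c)) refl (u f2) (u f0) (v f2) (v f0)
  cross-anti u v (suc (suc zero)) = solve 4 (λ a b c d →
      c :* b :- d :* a
      := :- (a :* d :- b :* c)) refl (u f0) (u f1) (v f0) (v f1)

  cross-self : ∀ u i → cross u u i ≈ 0#
  cross-self u zero = solve 2 (λ a b → a :* b :- b :* a := con (+ 0)) refl (u f1) (u f2)
  cross-self u (suc zero) = solve 2 (λ a b → a :* b :- b :* a := con (+ 0)) refl (u f2) (u f0)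
  cross-self u (suc (suc zero)) = solve 2 (λ a b → a :* b :- b :* a := con (+ 0)) refl (u f0) (u f1)

  dot-e : ∀ w m → dot w (col I3 m) ≈ w m
  dot-e w zero = solve 3 (λ a b c → a :* con (+ 1) :+ b :* con (+ 0) :+ c :* con (+ 0) := a) refl (w f0) (w f1) (w f2)
  dot-e w (suc zero) = solve 3 (λ a b c → a :* con (+ 0) :+ b :* con (+ 1) :+ c :* con (+ 0) := b) refl (w f0) (w f1) (w f2)
  dot-e w (suc (suc zero)) = solve 3 (λ a b c → a :* con (+ 0) :+ b :* con (+ 0) :+ c :* con (+ 1) := c) refl (w f0) (w f1) (w f2)

  triple-cyc : ∀ u v w → triple u v w ≈ triple v w u
  triple-cyc u v w = solve 9 (λ u0 u1 u2 v0 v1 v2 w0 w1 w2 →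
    (u1 :* v2 :- u2 :* v1) :* w0 :+ (u2 :* v0 :- u0 :* v2) :* w1 :+ (u0 :* v1 :- u1 :* v0) :* w2
    := (v1 :* w2 :- v2 :* w1) :* u0 :+ (v2 :* w0 :- v0 :* w2) :* u1 :+ (v0 :* w1 :- v1 :* w0) :* u2) refl
    (u f0) (u f1) (u f2) (v f0) (v f1) (v f2) (w f0) (w f1) (w f2)

  triple-mul : ∀ Y u v w → triple (mv Y u) (mv Y v) (mv Y w) ≈ det Y * triple u v w
  triple-mul Y u v w = solve 18 (λ a b c d e f g h i u0 u1 u2 v0 v1 v2 w0 w1 w2 →
    let M : _ → _ → _ → _
        M x y z = (a :* x :+ b :* y :+ c :* z)
        N : _ → _ → _ → _
        N x y z = (d :* x :+ e :* y :+ f :* z)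
        O : _ → _ → _ → _
        O x y z = (g :* x :+ h :* y :+ i :* z)
    in    (N u0 u1 u2 :* O v0 v1 v2 :- O u0 u1 u2 :* N v0 v1 v2) :* M w0 w1 w2
       :+ (O u0 u1 u2 :* M v0 v1 v2 :- M u0 u1 u2 :* O v0 v1 v2) :* N w0 w1 w2
       :+ (M u0 u1 u2 :* N v0 v1 v2 :- N u0 u1 u2 :* M v0 v1 v2) :* O w0 w1 w2
    := (a :* (e :* i :- f :* h) :- b :* (d :* i :- f :* g) :+ c :* (d :* h :- e :* g))
       :* ((u1 :* v2 :- u2 :* v1) :* w0 :+ (u2 :* v0 :- u0 :* v2) :* w1 :+ (u0 :* v1 :- u1 :* v0) :* w2)) refl
    (Y f0 f0) (Y f0 f1) (Y f0 f2) (Y f1 f0) (Y f1 f1) (Y f1 f2) (Y f2 f0) (Y f2 f1) (Y f2 f2)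
    (u f0) (u f1) (u f2) (v f0) (v f1) (v f2) (w f0) (w f1) (w f2)

  det-triple : ∀ A → det A ≈ triple (col A f0) (col A f1) (col A f2)
  det-triple A = solve 9 (λ a b c d e f g h i → a :* (e :* i :- f :* h) :- b :* (d :* i :- f :* g) :+ c :* (d :* h :- e :* g)
    := (d :* h :- g :* e) :* c :+ (g :* b :- a :* h) :* f :+ (a :* e :- d :* b) :* i) refl
    (A f0 f0) (A f0 f1) (A f0 f2) (A f1 f0) (A f1 f1) (A f1 f2) (A f2 f0) (A f2 f1) (A f2 f2)

  det-cong : ∀ {A B} → A ≈M B → det A ≈ det B
  det-cong {A} {B} e = +-cong (+-cong (*-cong (e f0 f0) (+-cong (*-cong (e f1 f1) (e f2 f2)) (-‿cong (*-cong (e f1 f2) (e f2 f1)))))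
     (-‿cong (*-cong (e f0 f1) (+-cong (*-cong (e f1 f0) (e f2 f2)) (-‿cong (*-cong (e f1 f2) (e f2 f0)))))))
     (*-cong (e f0 f2) (+-cong (*-cong (e f1 f0) (e f2 f1)) (-‿cong (*-cong (e f1 f1) (e f2 f0)))))

  det-· : ∀ A B → det (A · B) ≈ det A * det B
  det-· A B = solve 18 (λ a b c d e f g h i a' b' c' d' e' f' g' h' i' →
    let DD : _ → _ → _ → _ → _ → _ → _ → _ → _ → _
        DD a b c' d e f gg h i' = a :* (e :* i' :- f :* h) :- b :* (d :* i' :- f :* gg) :+ c' :* (d :* h :- e :* gg)
    in DD (a :* a' :+ b :* d' :+ c :* g') (a :* b' :+ b :* e' :+ c :* h') (a :* c' :+ b :* f' :+ c :* i')
      (d :* a' :+ e :* d' :+ f :* g') (d :* b' :+ e :* e' :+ f :* h') (d :* c' :+ e :* f' :+ f :* i')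
      (g :* a' :+ h :* d' :+ i :* g') (g :* b' :+ h :* e' :+ i :* h') (g :* c' :+ h :* f' :+ i :* i')
    := DD a b c d e f g h i :* DD a' b' c' d' e' f' g' h' i') refl
    (A f0 f0) (A f0 f1) (A f0 f2) (A f1 f0) (A f1 f1) (A f1 f2) (A f2 f0) (A f2 f1) (A f2 f2)
    (B f0 f0) (B f0 f1) (B f0 f2) (B f1 f0) (B f1 f1) (B f1 f2) (B f2 f0) (B f2 f1) (B f2 f2)

  det-I : det I3 ≈ 1#
  det-I = solve 0
    (con (+ 1) :* (con (+ 1) :* con (+ 1) :- con (+ 0) :* con (+ 0)) :- con (+ 0) :* (con (+ 0) :* con (+ 1) :- con (+ 0) :* con (+ 0))
       :+ con (+ 0) :* (con (+ 0) :* con (+ 0) :- con (+ 1) :* con (+ 0))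
     := con (+ 1)) refl

  det-scal : ∀ a A → det (scal a A) ≈ (a * a * a) * det A
  det-scal a A = solve 10 (λ x a b c d e f g h i →
       (x :* a) :* ((x :* e) :* (x :* i) :- (x :* f) :* (x :* h)) :- (x :* b) :* ((x :* d) :* (x :* i) :- (x :* f) :* (x :* g))
    :+ (x :* c) :* ((x :* d) :* (x :* h) :- (x :* e) :* (x :* g))
    := (x :* x :* x) :* (a :* (e :* i :- f :* h) :- b :* (d :* i :- f :* g) :+ c :* (d :* h :- e :* g))) refl
    a (A f0 f0) (A f0 f1) (A f0 f2) (A f1 f0) (A f1 f1) (A f1 f2) (A f2 f0) (A f2 f1) (A f2 f2)

  triple-repeat₁₃ : ∀ u v → triple u v u ≈ 0#
  triple-repeat₁₃ u v = solve 6 (λ u0 u1 u2 v0 v1 v2 →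
    (u1 :* v2 :- u2 :* v1) :* u0 :+ (u2 :* v0 :- u0 :* v2) :* u1 :+ (u0 :* v1 :- u1 :* v0) :* u2 := con (+ 0)) refl
    (u f0) (u f1) (u f2) (v f0) (v f1) (v f2)

  triple-repeat₂₃ : ∀ u v → triple u v v ≈ 0#
  triple-repeat₂₃ u v = trans (sym (triple-cyc v u v)) (triple-repeat₁₃ v u)

  adj-l : ∀ A → (adj A · A) ≈M scal (det A) I3
  adj-l A = λ where
      zero             zero             → diagonal (triple-cyc c₀ c₁ c₂)
      zero             (suc zero)       → off-diagonal (triple-repeat₁₃ c₁ c₂)
      zero             (suc (suc zero)) → off-diagonal (triple-repeat₂₃ c₁ c₂)
      (suc zero)       zero             → off-diagonal (triple-repeat₂₃ c₂ c₀)
      (suc zero)       (suc zero)       → diagonal (trans (triple-cyc c₀ c₁ c₂) (triple-cyc c₁ c₂ c₀))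
      (suc zero)       (suc (suc zero)) → off-diagonal (triple-repeat₁₃ c₂ c₀)
      (suc (suc zero)) zero             → off-diagonal (triple-repeat₁₃ c₀ c₁)
      (suc (suc zero)) (suc zero)       → off-diagonal (triple-repeat₂₃ c₀ c₁)
      (suc (suc zero)) (suc (suc zero)) → diagonal refl
    where
    c₀ c₁ c₂ : Vec3
    c₀ = col A f0
    c₁ = col A f1
    c₂ = col A f2
    diagonal : ∀ {x} → triple c₀ c₁ c₂ ≈ x → x ≈ det A * 1#
    diagonal e = trans (sym e) (trans (sym (det-triple A)) (sym (*-identityʳ _)))
    off-diagonal : ∀ {x} → x ≈ 0# → x ≈ det A * 0#
    off-diagonal e = trans e (sym (zeroʳ _))

  adj-r : ∀ A → (A · adj A) ≈M scal (det A) I3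
  adj-r A zero zero = solve 9 (λ a00 a01 a02 a10 a11 a12 a20 a21 a22 →
      (a00 :* (a11 :* a22 :- a21 :* a12) :+ a01 :* (a12 :* a20 :- a22 :* a10) :+ a02 :* (a10 :* a21 :- a20 :* a11))
      := (a00 :* (a11 :* a22 :- a12 :* a21) :- a01 :* (a10 :* a22 :- a12 :* a20) :+ a02 :* (a10 :* a21 :- a11 :* a20)) :* con (+ 1)) refl
      (A f0 f0) (A f0 f1) (A f0 f2) (A f1 f0) (A f1 f1) (A f1 f2) (A f2 f0) (A f2 f1) (A f2 f2)
  adj-r A zero (suc zero) = solve 9 (λ a00 a01 a02 a10 a11 a12 a20 a21 a22 →
      (a00 :* (a21 :* a02 :- a01 :* a22) :+ a01 :* (a22 :* a00 :- a02 :* a20) :+ a02 :* (a20 :* a01 :- a00 :* a21))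
      := (a00 :* (a11 :* a22 :- a12 :* a21) :- a01 :* (a10 :* a22 :- a12 :* a20) :+ a02 :* (a10 :* a21 :- a11 :* a20)) :* con (+ 0)) refl
      (A f0 f0) (A f0 f1) (A f0 f2) (A f1 f0) (A f1 f1) (A f1 f2) (A f2 f0) (A f2 f1) (A f2 f2)
  adj-r A zero (suc (suc zero)) = solve 9 (λ a00 a01 a02 a10 a11 a12 a20 a21 a22 →
      (a00 :* (a01 :* a12 :- a11 :* a02) :+ a01 :* (a02 :* a10 :- a12 :* a00) :+ a02 :* (a00 :* a11 :- a10 :* a01))
      := (a00 :* (a11 :* a22 :- a12 :* a21) :- a01 :* (a10 :* a22 :- a12 :* a20) :+ a02 :* (a10 :* a21 :- a11 :* a20)) :* con (+ 0)) refl
      (A f0 f0) (A f0 f1) (A f0 f2) (A f1 f0) (A f1 f1) (A f1 f2) (A f2 f0) (A f2 f1) (A f2 f2)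
  adj-r A (suc zero) zero = solve 9 (λ a00 a01 a02 a10 a11 a12 a20 a21 a22 →
      (a10 :* (a11 :* a22 :- a21 :* a12) :+ a11 :* (a12 :* a20 :- a22 :* a10) :+ a12 :* (a10 :* a21 :- a20 :* a11))
      := (a00 :* (a11 :* a22 :- a12 :* a21) :- a01 :* (a10 :* a22 :- a12 :* a20) :+ a02 :* (a10 :* a21 :- a11 :* a20)) :* con (+ 0)) refl
      (A f0 f0) (A f0 f1) (A f0 f2) (A f1 f0) (A f1 f1) (A f1 f2) (A f2 f0) (A f2 f1) (A f2 f2)
  adj-r A (suc zero) (suc zero) = solve 9 (λ a00 a01 a02 a10 a11 a12 a20 a21 a22 →
      (a10 :* (a21 :* a02 :- a01 :* a22) :+ a11 :* (a22 :* a00 :- a02 :* a20) :+ a12 :* (a20 :* a01 :- a00 :* a21))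
      := (a00 :* (a11 :* a22 :- a12 :* a21) :- a01 :* (a10 :* a22 :- a12 :* a20) :+ a02 :* (a10 :* a21 :- a11 :* a20)) :* con (+ 1)) refl
      (A f0 f0) (A f0 f1) (A f0 f2) (A f1 f0) (A f1 f1) (A f1 f2) (A f2 f0) (A f2 f1) (A f2 f2)
  adj-r A (suc zero) (suc (suc zero)) = solve 9 (λ a00 a01 a02 a10 a11 a12 a20 a21 a22 →
      (a10 :* (a01 :* a12 :- a11 :* a02) :+ a11 :* (a02 :* a10 :- a12 :* a00) :+ a12 :* (a00 :* a11 :- a10 :* a01))
      := (a00 :* (a11 :* a22 :- a12 :* a21) :- a01 :* (a10 :* a22 :- a12 :* a20) :+ a02 :* (a10 :* a21 :- a11 :* a20)) :* con (+ 0)) refl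
      (A f0 f0) (A f0 f1) (A f0 f2) (A f1 f0) (A f1 f1) (A f1 f2) (A f2 f0) (A f2 f1) (A f2 f2)
  adj-r A (suc (suc zero)) zero = solve 9 (λ a00 a01 a02 a10 a11 a12 a20 a21 a22 →
      (a20 :* (a11 :* a22 :- a21 :* a12) :+ a21 :* (a12 :* a20 :- a22 :* a10) :+ a22 :* (a10 :* a21 :- a20 :* a11))
      := (a00 :* (a11 :* a22 :- a12 :* a21) :- a01 :* (a10 :* a22 :- a12 :* a20) :+ a02 :* (a10 :* a21 :- a11 :* a20)) :* con (+ 0)) refl
      (A f0 f0) (A f0 f1) (A f0 f2) (A f1 f0) (A f1 f1) (A f1 f2) (A f2 f0) (A f2 f1) (A f2 f2)
  adj-r A (suc (suc zero)) (suc zero) = solve 9 (λ a00 a01 a02 a10 a11 a12 a20 a21 a22 →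
      (a20 :* (a21 :* a02 :- a01 :* a22) :+ a21 :* (a22 :* a00 :- a02 :* a20) :+ a22 :* (a20 :* a01 :- a00 :* a21))
      := (a00 :* (a11 :* a22 :- a12 :* a21) :- a01 :* (a10 :* a22 :- a12 :* a20) :+ a02 :* (a10 :* a21 :- a11 :* a20)) :* con (+ 0)) refl
      (A f0 f0) (A f0 f1) (A f0 f2) (A f1 f0) (A f1 f1) (A f1 f2) (A f2 f0) (A f2 f1) (A f2 f2)
  adj-r A (suc (suc zero)) (suc (suc zero)) = solve 9 (λ a00 a01 a02 a10 a11 a12 a20 a21 a22 →
      (a20 :* (a01 :* a12 :- a11 :* a02) :+ a21 :* (a02 :* a10 :- a12 :* a00) :+ a22 :* (a00 :* a11 :- a10 :* a01))
      := (a00 :* (a11 :* a22 :- a12 :* a21) :- a01 :* (a10 :* a22 :- a12 :* a20) :+ a02 :* (a10 :* a21 :- a11 :* a20)) :* con (+ 1)) refl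
      (A f0 f0) (A f0 f1) (A f0 f2) (A f1 f0) (A f1 f1) (A f1 f2) (A f2 f0) (A f2 f1) (A f2 f2)

  _⊗_ : GL3 → GL3 → GL3

  g ⊗ h = record
    { mat = mat g · mat h
    ; inv = inv h · inv g
    ; invˡ = ≈M-trans (·-assoc (inv h) (inv g) (mat g · mat h))
             (≈M-trans (·-cong (≈M-refl {inv h}) (≈M-sym (·-assoc (inv g) (mat g) (mat h))))
             (≈M-trans (·-cong (≈M-refl {inv h}) (·-cong (invˡ g) (≈M-refl {mat h})))
             (≈M-trans (·-cong (≈M-refl {inv h}) (I-· (mat h))) (invˡ h))))
    ; invʳ = ≈M-trans (·-assoc (mat g) (mat h) (inv h · inv g))
             (≈M-trans (·-cong (≈M-refl {mat g}) (≈M-sym (·-assoc (mat h) (inv h) (inv g))))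
             (≈M-trans (·-cong (≈M-refl {mat g}) (·-cong (invʳ h) (≈M-refl {inv g})))
             (≈M-trans (·-cong (≈M-refl {mat g}) (I-· (inv g))) (invʳ g))))
    }

  scal-I-inv : ∀ {a b} → a * b ≈ 1# → scal b (scal a I3) ≈M I3
  scal-I-inv {a} {b} e = ≈M-trans (scal-scal b a I3) (≈M-trans (scal-cong (trans (*-comm b a) e) ≈M-refl) (scal-1 I3))

  mkGL : (A : Mat3) → Inv (det A) → GL3
  mkGL A i = record
    { mat = A
    ; inv = scal (Inv.x⁻¹ i) (adj A)
    ; invˡ = ≈M-trans (scal-· _ (adj A) A) (≈M-trans (scal-cong refl (adj-l A)) (scal-I-inv (Inv.x*x⁻¹ i)))
    ; invʳ = ≈M-trans (·-scal _ A (adj A)) (≈M-trans (scal-cong refl (adj-r A)) (scal-I-inv (Inv.x*x⁻¹ i)))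
    }

  det-GL : ∀ g → det (mat g) * det (inv g) ≈ 1#
  det-GL g = trans (sym (det-· (mat g) (inv g))) (trans (det-cong (invʳ g)) det-I)

  invDet : ∀ g → Inv (det (mat g))
  invDet g = record { x⁻¹ = det (inv g) ; x*x⁻¹ = det-GL g }

  left-inv-unique : ∀ {A B} → (B · A) ≈M I3 → (i : Inv (det A)) → B ≈M scal (Inv.x⁻¹ i) (adj A)
  left-inv-unique {A} {B} e i = MR.begin
    B MR.≈⟨ ≈M-sym (·-I B) ⟩
    B · I3 MR.≈⟨ ·-cong (≈M-refl {B}) (≈M-sym (scal-I-inv (Inv.x*x⁻¹ i))) ⟩
    B · scal (Inv.x⁻¹ i) (scal (det A) I3) MR.≈⟨ ·-cong (≈M-refl {B}) (scal-cong refl (≈M-sym (adj-r A))) ⟩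
    B · scal (Inv.x⁻¹ i) (A · adj A) MR.≈⟨ ·-scal _ B (A · adj A) ⟩
    scal (Inv.x⁻¹ i) (B · (A · adj A)) MR.≈⟨ scal-cong refl (≈M-sym (·-assoc B A (adj A))) ⟩
    scal (Inv.x⁻¹ i) ((B · A) · adj A) MR.≈⟨ scal-cong refl (·-cong e (≈M-refl {adj A})) ⟩
    scal (Inv.x⁻¹ i) (I3 · adj A) MR.≈⟨ scal-cong refl (I-· (adj A)) ⟩
    scal (Inv.x⁻¹ i) (adj A) MR.∎

  ≤ν-sum3 : ∀ {z f} → (∀ j → z ≤ν f j) → z ≤ν sum3 f
  ≤ν-sum3 h = ≤ν-+ (≤ν-+ (h f0) (h f1)) (h f2)

  ≤ν-dot : ∀ {a b u v} → (∀ i → a ≤ν u i) → (∀ i → b ≤ν v i) → a ℤ.+ b ≤ν dot u v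
  ≤ν-dot hu hv = ≤ν-sum3 (λ j → ≤ν-* (hu j) (hv j))

  ≤ν-cross : ∀ {a b u v} → (∀ i → a ≤ν u i) → (∀ i → b ≤ν v i) → ∀ i → a ℤ.+ b ≤ν cross u v i
  ≤ν-cross hu hv zero = ≤ν-- (≤ν-* (hu f1) (hv f2)) (≤ν-* (hu f2) (hv f1))
  ≤ν-cross hu hv (suc zero) = ≤ν-- (≤ν-* (hu f2) (hv f0)) (≤ν-* (hu f0) (hv f2))
  ≤ν-cross hu hv (suc (suc zero)) = ≤ν-- (≤ν-* (hu f0) (hv f1)) (≤ν-* (hu f1) (hv f0))

  ≤ν-det : ∀ {a A} → (∀ i j → a ≤ν A i j) → (a ℤ.+ a) ℤ.+ a ≤ν det A
  ≤ν-det {a} {A} h = ≤ν-cong (sym (det-triple A)) (≤ν-dot (≤ν-cross (λ i → h i f0) (λ i → h i f1)) (λ i → h i f2))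

  ≤ν-· : ∀ {a b A B} → (∀ i j → a ≤ν A i j) → (∀ i j → b ≤ν B i j) → ∀ i j → a ℤ.+ b ≤ν (A · B) i j
  ≤ν-· hA hB i j = ≤ν-sum3 (λ k → ≤ν-* (hA i k) (hB k j))

  ≤ν-mv : ∀ {a b A x} → (∀ i j → a ≤ν A i j) → (∀ i → b ≤ν x i) → ∀ i → a ℤ.+ b ≤ν mv A x i
  ≤ν-mv hA hx i = ≤ν-sum3 (λ k → ≤ν-* (hA i k) (hx k))

  ≤ν-adj : ∀ {a A} → (∀ i j → a ≤ν A i j) → ∀ i j → a ℤ.+ a ≤ν adj A i j
  ≤ν-adj h zero = ≤ν-cross (λ i → h i f1) (λ i → h i f2)
  ≤ν-adj h (suc zero) = ≤ν-cross (λ i → h i f2) (λ i → h i f0)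
  ≤ν-adj h (suc (suc zero)) = ≤ν-cross (λ i → h i f0) (λ i → h i f1)

  Integral-· : ∀ {A B} → Integral A → Integral B → Integral (A · B)
  Integral-· = ≤ν-·

  Integral-cong : ∀ {A B} → A ≈M B → Integral A → Integral B
  Integral-cong e h i j = ≤ν-cong (e i j) (h i j)

  Integral-I3 : Integral I3
  Integral-I3 zero zero = ≤ν-1#
  Integral-I3 zero (suc zero) = ≤ν-0#
  Integral-I3 zero (suc (suc zero)) = ≤ν-0#
  Integral-I3 (suc zero) zero = ≤ν-0#
  Integral-I3 (suc zero) (suc zero) = ≤ν-1#
  Integral-I3 (suc zero) (suc (suc zero)) = ≤ν-0#
  Integral-I3 (suc (suc zero)) zero = ≤ν-0#
  Integral-I3 (suc (suc zero)) (suc zero) = ≤ν-0#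
  Integral-I3 (suc (suc zero)) (suc (suc zero)) = ≤ν-1#

  ≤ν-adj⇒≤ν-cross-cols : ∀ {z A} → (∀ i j → z ≤ν adj A i j) → ∀ a b i → z ≤ν cross (col A a) (col A b) i
  ≤ν-adj⇒≤ν-cross-cols {z} {A} h zero zero i = ≤ν-cong (sym (cross-self (col A f0) i)) ≤ν-0#
  ≤ν-adj⇒≤ν-cross-cols {z} {A} h zero (suc zero) i = h f2 i
  ≤ν-adj⇒≤ν-cross-cols {z} {A} h zero (suc (suc zero)) i = ≤ν-cong (sym (cross-anti (col A f2) (col A f0) i)) (≤ν-neg (h f1 i))
  ≤ν-adj⇒≤ν-cross-cols {z} {A} h (suc zero) zero i = ≤ν-cong (sym (cross-anti (col A f0) (col A f1) i)) (≤ν-neg (h f2 i))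
  ≤ν-adj⇒≤ν-cross-cols {z} {A} h (suc zero) (suc zero) i = ≤ν-cong (sym (cross-self (col A f1) i)) ≤ν-0#
  ≤ν-adj⇒≤ν-cross-cols {z} {A} h (suc zero) (suc (suc zero)) i = h f0 i
  ≤ν-adj⇒≤ν-cross-cols {z} {A} h (suc (suc zero)) zero i = h f1 i
  ≤ν-adj⇒≤ν-cross-cols {z} {A} h (suc (suc zero)) (suc zero) i = ≤ν-cong (sym (cross-anti (col A f1) (col A f2) i)) (≤ν-neg (h f0 i))
  ≤ν-adj⇒≤ν-cross-cols {z} {A} h (suc (suc zero)) (suc (suc zero)) i = ≤ν-cong (sym (cross-self (col A f2) i)) ≤ν-0#

  1≤ν-row₂⇒1≤ν-adj-cols₀₁ : ∀ {Z} → Integral Z → (∀ k → + 1 ≤ν Z f2 k) → ∀ i → + 1 ≤ν adj Z i f0 × + 1 ≤ν adj Z i f1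
  1≤ν-row₂⇒1≤ν-adj-cols₀₁ {Z} hZ h2 zero =
    ≤ν-- (≤ν-* (hZ f1 f1) (h2 f2)) (≤ν-* (h2 f1) (hZ f1 f2)) ,
    ≤ν-- (≤ν-* (h2 f1) (hZ f0 f2)) (≤ν-* (hZ f0 f1) (h2 f2))
  1≤ν-row₂⇒1≤ν-adj-cols₀₁ {Z} hZ h2 (suc zero) =
    ≤ν-- (≤ν-* (hZ f1 f2) (h2 f0)) (≤ν-* (h2 f2) (hZ f1 f0)) ,
    ≤ν-- (≤ν-* (h2 f2) (hZ f0 f0)) (≤ν-* (hZ f0 f2) (h2 f0))
  1≤ν-row₂⇒1≤ν-adj-cols₀₁ {Z} hZ h2 (suc (suc zero)) =
    ≤ν-- (≤ν-* (hZ f1 f0) (h2 f1)) (≤ν-* (h2 f0) (hZ f1 f1)) ,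
    ≤ν-- (≤ν-* (h2 f0) (hZ f0 f1)) (≤ν-* (hZ f0 f0) (h2 f1))

  unit-entry? : (A : Mat3) → (∃ λ i → ∃ λ j → Unit (A i j)) ⊎ (∀ i j → ¬ Unit (A i j))
  unit-entry? A with any? (λ i → any? (λ j → Unit? (A i j)))
  ... | yes (i , j , u) = inj₁ (i , j , u)
  ... | no n = inj₂ (λ i j u → n (i , j , u))

  unit-component? : (v : Vec3) → (∃ λ j → Unit (v j)) ⊎ (∀ j → ¬ Unit (v j))
  unit-component? v with any? (λ j → Unit? (v j))
  ... | yes (j , u) = inj₁ (j , u)
  ... | no n = inj₂ (λ j u → n (j , u))

  1≤ν-entries⇒3≤val-det : ∀ {A} → (∀ i j → + 1 ≤ν A i j) → Nonzero (det A) → + 3 ℤ.≤ val (det A)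
  1≤ν-entries⇒3≤val-det {A} h nz = ≤ν⇒≤val nz (≤ν-det h)

  infix 4 _∥π_
  _∥π_ : Vec3 → Vec3 → Set
  u ∥π v = ∀ k → + 1 ≤ν cross u v k

  ∥π⇒minors : ∀ {u p} → u ∥π p → ∀ j i → + 1 ≤ν p j * u i - u j * p i
  ∥π⇒minors {u} {p} h zero zero = ≤ν-cong (sym (solve 2 (λ a b →
      a :* b :- b :* a
      := con (+ 0)) refl (p f0) (u f0))) ≤ν-0#
  ∥π⇒minors {u} {p} h zero (suc zero) = ≤ν-cong (solve 4 (λ u0 u1 p0 p1 →
      :- (u0 :* p1 :- u1 :* p0)
      := p0 :* u1 :- u0 :* p1) refl (u f0) (u f1) (p f0) (p f1)) (≤ν-neg (h f2))
  ∥π⇒minors {u} {p} h zero (suc (suc zero)) = ≤ν-cong (solve 4 (λ u0 u2 p0 p2 →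
      u2 :* p0 :- u0 :* p2
      := p0 :* u2 :- u0 :* p2) refl (u f0) (u f2) (p f0) (p f2)) (h f1)
  ∥π⇒minors {u} {p} h (suc zero) zero = ≤ν-cong (solve 4 (λ u0 u1 p0 p1 →
      u0 :* p1 :- u1 :* p0
      := p1 :* u0 :- u1 :* p0) refl (u f0) (u f1) (p f0) (p f1)) (h f2)
  ∥π⇒minors {u} {p} h (suc zero) (suc zero) = ≤ν-cong (sym (solve 2 (λ a b →
      a :* b :- b :* a
      := con (+ 0)) refl (p f1) (u f1))) ≤ν-0#
  ∥π⇒minors {u} {p} h (suc zero) (suc (suc zero)) = ≤ν-cong (solve 4 (λ u1 u2 p1 p2 →
      :- (u1 :* p2 :- u2 :* p1)
      := p1 :* u2 :- u1 :* p2) refl (u f1) (u f2) (p f1) (p f2)) (≤ν-neg (h f0))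
  ∥π⇒minors {u} {p} h (suc (suc zero)) zero = ≤ν-cong (solve 4 (λ u0 u2 p0 p2 →
      :- (u2 :* p0 :- u0 :* p2)
      := p2 :* u0 :- u2 :* p0) refl (u f0) (u f2) (p f0) (p f2)) (≤ν-neg (h f1))
  ∥π⇒minors {u} {p} h (suc (suc zero)) (suc zero) = ≤ν-cong (solve 4 (λ u1 u2 p1 p2 →
      u1 :* p2 :- u2 :* p1
      := p2 :* u1 :- u2 :* p1) refl (u f1) (u f2) (p f1) (p f2)) (h f0)
  ∥π⇒minors {u} {p} h (suc (suc zero)) (suc (suc zero)) = ≤ν-cong (sym (solve 2 (λ a b →
      a :* b :- b :* a
      := con (+ 0)) refl (p f2) (u f2))) ≤ν-0#

  cross-bilin : ∀ a α β u v p i →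
                a * (a * cross u v i) ≈
                (cross (λ k → a * u k - α * p k) (λ k → a * v k - β * p k) i + (a * β) * cross u p i) - (α * a) * cross v p i
  cross-bilin a α β u v p zero = solve 12 (λ a α β u0 u1 u2 v0 v1 v2 p0 p1 p2 →
    a :* (a :* (u1 :* v2 :- u2 :* v1))
    := ((a :* u1 :- α :* p1) :* (a :* v2 :- β :* p2) :- (a :* u2 :- α :* p2) :* (a :* v1 :- β :* p1) :+ (a :* β) :* (u1 :* p2 :- u2 :* p1)) :- (α :* a) :* (v1 :* p2 :- v2 :* p1)) refl
    a α β (u f0) (u f1) (u f2) (v f0) (v f1) (v f2) (p f0) (p f1) (p f2)
  cross-bilin a α β u v p (suc zero) = solve 12 (λ a α β u0 u1 u2 v0 v1 v2 p0 p1 p2 →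
    a :* (a :* (u2 :* v0 :- u0 :* v2))
    := ((a :* u2 :- α :* p2) :* (a :* v0 :- β :* p0) :- (a :* u0 :- α :* p0) :* (a :* v2 :- β :* p2) :+ (a :* β) :* (u2 :* p0 :- u0 :* p2)) :- (α :* a) :* (v2 :* p0 :- v0 :* p2)) refl
    a α β (u f0) (u f1) (u f2) (v f0) (v f1) (v f2) (p f0) (p f1) (p f2)
  cross-bilin a α β u v p (suc (suc zero)) = solve 12 (λ a α β u0 u1 u2 v0 v1 v2 p0 p1 p2 →
    a :* (a :* (u0 :* v1 :- u1 :* v0))
    := ((a :* u0 :- α :* p0) :* (a :* v1 :- β :* p1) :- (a :* u1 :- α :* p1) :* (a :* v0 :- β :* p0) :+ (a :* β) :* (u0 :* p1 :- u1 :* p0)) :- (α :* a) :* (v0 :* p1 :- v1 :* p0)) refl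
    a α β (u f0) (u f1) (u f2) (v f0) (v f1) (v f2) (p f0) (p f1) (p f2)

  -- With a = p j a unit, a u − u j p and a v − v j p vanish modulo π, and
  -- a² (u × v) = (a u − u j p) × (a v − v j p) + a (v j) (u × p) − (u j) a (v × p).
  ∥π-trans : ∀ {u v p j} → IntegralV u → IntegralV v → IntegralV p → Unit (p j) → u ∥π p → v ∥π p → u ∥π v
  ∥π-trans {u} {v} {p} {j} hu hv hp uj hup hvp i =
    ≤ν-unit-cancel uj (≤ν-unit-cancel uj (≤ν-cong (sym (cross-bilin (p j) (u j) (v j) u v p i))
      (≤ν-- (≤ν-+ (≤ν-weaken (ℤ.+≤+ (ℕ.s≤s ℕ.z≤n)) (≤ν-cross (∥π⇒minors hup j) (∥π⇒minors hvp j) i))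
                  (≤ν-* (≤ν-* (hp j) (hv j)) (hup i)))
            (≤ν-* (≤ν-* (hu j) (hp j)) (hvp i)))))


module Lattices {c ℓ : Level} {q : ℕ} (K : NALocalField c ℓ q) where

  open import Data.Integer as ℤ using (ℤ; +_; -[1+_])
  import Data.Integer.Properties as ℤP
  open Matrices K public

  -- The lattice s · g 𝒪³ itself, as opposed to its homothety class (a vertex).
  record Lattice : Set (c ⊔ ℓ) where
    constructor lat
    field
      s : Carrier
      sI : Inv s
      g : GL3
  open Lattice public

  s⁻¹ : Lattice → Carrier
  s⁻¹ X = Inv.x⁻¹ (sI X)

  infix 4 _⊆_ _⊊_ _≅_
  _⊆_ : Lattice → Lattice → Set (c ⊔ ℓ)
  X ⊆ Y = Incl (s X) (g X) (s Y) (g Y)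

  -- The matrix of the basis of X in the basis of Y: X ⊆ Y iff it is integral.
  rel : Lattice → Lattice → Mat3
  rel X Y = scal (s X * s⁻¹ Y) (inv (g Y) · mat (g X))

  b*[a*b⁻¹]≈a : ∀ {a b} (i : Inv b) → b * (a * Inv.x⁻¹ i) ≈ a
  b*[a*b⁻¹]≈a {a} {b} i = trans (solve 3 (λ a b c → b :* (a :* c) := a :* (b :* c)) refl a b _)
                                (trans (*-congˡ (Inv.x*x⁻¹ i)) (*-identityʳ a))

  rel-basis : ∀ X Y → scal (s Y) (mat (g Y) · rel X Y) ≈M scal (s X) (mat (g X))
  rel-basis X Y = MR.begin
    scal (s Y) (mat (g Y) · rel X Y) MR.≈⟨ scal-congʳ (s Y) (·-scal (s X * s⁻¹ Y) (mat (g Y)) (inv (g Y) · mat (g X))) ⟩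
    scal (s Y) (scal (s X * s⁻¹ Y) (mat (g Y) · (inv (g Y) · mat (g X))))
      MR.≈⟨ scal-congʳ (s Y) (scal-congʳ (s X * s⁻¹ Y) (≈M-sym (·-assoc (mat (g Y)) (inv (g Y)) (mat (g X))))) ⟩
    scal (s Y) (scal (s X * s⁻¹ Y) ((mat (g Y) · inv (g Y)) · mat (g X)))
      MR.≈⟨ scal-congʳ (s Y) (scal-congʳ (s X * s⁻¹ Y) (·-congʳ (mat (g X)) (invʳ (g Y)))) ⟩
    scal (s Y) (scal (s X * s⁻¹ Y) (I3 · mat (g X))) MR.≈⟨ scal-congʳ (s Y) (scal-congʳ (s X * s⁻¹ Y) (I-· (mat (g X)))) ⟩
    scal (s Y) (scal (s X * s⁻¹ Y) (mat (g X))) MR.≈⟨ scal-scal _ _ _ ⟩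
    scal (s Y * (s X * s⁻¹ Y)) (mat (g X)) MR.≈⟨ scal-congˡ (mat (g X)) (b*[a*b⁻¹]≈a (sI Y)) ⟩
    scal (s X) (mat (g X)) MR.∎

  Integral⇒⊆ : ∀ X Y → Integral (rel X Y) → X ⊆ Y
  Integral⇒⊆ X Y hR v (w , (x , xi , wx) , vw) = mv (mat (g Y)) (mv (rel X Y) x) , (mv (rel X Y) x , ≤ν-mv hR xi , λ i → refl) , λ i → begin
    v i ≈⟨ vw i ⟩
    s X * w i ≈⟨ *-congˡ (wx i) ⟩
    s X * mv (mat (g X)) x i ≈⟨ sym (mv-scal (s X) (mat (g X)) x i) ⟩
    mv (scal (s X) (mat (g X))) x i ≈⟨ mv-congˡ x (≈M-sym (rel-basis X Y)) i ⟩
    mv (scal (s Y) (mat (g Y) · rel X Y)) x i ≈⟨ mv-scal (s Y) (mat (g Y) · rel X Y) x i ⟩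
    s Y * mv (mat (g Y) · rel X Y) x i ≈⟨ *-congˡ (mv-· (mat (g Y)) (rel X Y) x i) ⟩
    s Y * mv (mat (g Y)) (mv (rel X Y) x) i ∎

  ⊆⇒Integral : ∀ X Y → X ⊆ Y → Integral (rel X Y)
  ⊆⇒Integral X Y h i j
    with h (λ k → s X * mat (g X) k j) (col (mat (g X)) j , (col I3 j , (λ k → Integral-I3 k j) , λ k → sym (·-I (mat (g X)) k j)) , λ k → refl)
  ... | w' , (y , yi , w'y) , vw' = ≤ν-cong (sym e) (yi i)
    where
    iY gY : Mat3
    iY = inv (g Y)
    gY = mat (g Y)
    e : rel X Y i j ≈ y i
    e = begin
      (s X * s⁻¹ Y) * (iY · mat (g X)) i j ≈⟨ solve 3 (λ a b c → (a :* b) :* c := b :* (a :* c)) refl (s X) (s⁻¹ Y) _ ⟩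
      s⁻¹ Y * (s X * mv iY (col (mat (g X)) j) i) ≈⟨ *-congˡ (sym (mv-scalʳ iY (s X) (col (mat (g X)) j) i)) ⟩
      s⁻¹ Y * mv iY (λ k → s X * mat (g X) k j) i ≈⟨ *-congˡ (mv-congʳ iY vw' i) ⟩
      s⁻¹ Y * mv iY (λ k → s Y * w' k) i ≈⟨ *-congˡ (mv-scalʳ iY (s Y) w' i) ⟩
      s⁻¹ Y * (s Y * mv iY w' i) ≈⟨ *-congˡ (*-congˡ (mv-congʳ iY w'y i)) ⟩
      s⁻¹ Y * (s Y * mv iY (mv gY y) i) ≈⟨ *-congˡ (*-congˡ (sym (mv-· iY gY y i))) ⟩
      s⁻¹ Y * (s Y * mv (iY · gY) y i) ≈⟨ *-congˡ (*-congˡ (mv-congˡ y (invˡ (g Y)) i)) ⟩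
      s⁻¹ Y * (s Y * mv I3 y i) ≈⟨ *-congˡ (*-congˡ (mv-I y i)) ⟩
      s⁻¹ Y * (s Y * y i) ≈⟨ sym (*-assoc _ _ _) ⟩
      (s⁻¹ Y * s Y) * y i ≈⟨ *-congʳ (trans (*-comm _ _) (Inv.x*x⁻¹ (sI Y))) ⟩
      1# * y i ≈⟨ *-identityˡ _ ⟩
      y i ∎

  rel-comp : ∀ X Y Z → (rel Y Z · rel X Y) ≈M rel X Z
  rel-comp X Y Z = MR.begin
    scal (s Y * s⁻¹ Z) (iZ · gY) · scal (s X * s⁻¹ Y) (iY · gX)
      MR.≈⟨ scal-· (s Y * s⁻¹ Z) (iZ · gY) (scal (s X * s⁻¹ Y) (iY · gX)) ⟩
    scal (s Y * s⁻¹ Z) ((iZ · gY) · scal (s X * s⁻¹ Y) (iY · gX))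
      MR.≈⟨ scal-congʳ (s Y * s⁻¹ Z) (·-scal (s X * s⁻¹ Y) (iZ · gY) (iY · gX)) ⟩
    scal (s Y * s⁻¹ Z) (scal (s X * s⁻¹ Y) ((iZ · gY) · (iY · gX)))
      MR.≈⟨ scal-scal (s Y * s⁻¹ Z) (s X * s⁻¹ Y) ((iZ · gY) · (iY · gX)) ⟩
    scal ((s Y * s⁻¹ Z) * (s X * s⁻¹ Y)) ((iZ · gY) · (iY · gX)) MR.≈⟨ scal-cong ratio-comp basis-comp ⟩
    scal (s X * s⁻¹ Z) (iZ · gX) MR.∎
    where
    iZ gY iY gX : Mat3
    iZ = inv (g Z)
    gY = mat (g Y)
    iY = inv (g Y)
    gX = mat (g X)
    ratio-comp : (s Y * s⁻¹ Z) * (s X * s⁻¹ Y) ≈ s X * s⁻¹ Z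
    ratio-comp = trans (solve 4 (λ a b c d → (a :* b) :* (c :* d) := (c :* b) :* (a :* d)) refl (s Y) (s⁻¹ Z) (s X) (s⁻¹ Y))
           (trans (*-congˡ (Inv.x*x⁻¹ (sI Y))) (*-identityʳ _))
    basis-comp : ((iZ · gY) · (iY · gX)) ≈M (iZ · gX)
    basis-comp = MR.begin
      (iZ · gY) · (iY · gX) MR.≈⟨ ·-assoc iZ gY (iY · gX) ⟩
      iZ · (gY · (iY · gX)) MR.≈⟨ ·-congˡ iZ (≈M-sym (·-assoc gY iY gX)) ⟩
      iZ · ((gY · iY) · gX) MR.≈⟨ ·-congˡ iZ (·-congʳ gX (invʳ (g Y))) ⟩
      iZ · (I3 · gX) MR.≈⟨ ·-congˡ iZ (I-· gX) ⟩
      iZ · gX MR.∎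

  rel-refl : ∀ X → rel X X ≈M I3
  rel-refl X = ≈M-trans (scal-cong (Inv.x*x⁻¹ (sI X)) (invˡ (g X))) (scal-1 I3)

  vol : Lattice → ℤ
  vol X = ((val (s X) ℤ.+ val (s X)) ℤ.+ val (s X)) ℤ.+ val (det (mat (g X)))

  Inv-det-inv : ∀ (h : GL3) → Inv (det (inv h))
  Inv-det-inv h = Inv-inv (invDet h)

  det-rel : ∀ X Y → det (rel X Y) ≈ ((s X * s⁻¹ Y) * (s X * s⁻¹ Y) * (s X * s⁻¹ Y)) * (det (inv (g Y)) * det (mat (g X)))
  det-rel X Y = trans (det-scal (s X * s⁻¹ Y) (inv (g Y) · mat (g X))) (*-congˡ (det-· (inv (g Y)) (mat (g X))))

  Inv-ratio : ∀ X Y → Inv (s X * s⁻¹ Y)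
  Inv-ratio X Y = Inv-* (sI X) (Inv-inv (sI Y))

  Inv-det-rel : ∀ X Y → Inv (det (rel X Y))
  Inv-det-rel X Y = Inv-cong (sym (det-rel X Y))
    (Inv-* (Inv-* (Inv-* (Inv-ratio X Y) (Inv-ratio X Y)) (Inv-ratio X Y)) (Inv-* (Inv-det-inv (g Y)) (invDet (g X))))

  open IntegerArithmetic
  open import Data.Integer.Tactic.RingSolver using (solve-∀)

  val-det-inv : ∀ h → val (det (inv h)) ≡ ℤ.- val (det (mat h))
  val-det-inv h = val-inv (invDet h)

  val-det-rel : ∀ X Y → val (det (rel X Y)) ≡ vol X ℤ.- vol Y
  val-det-rel X Y =
    P.trans (val-cong (det-rel X Y)) (P.trans (val-*-Inv ρ³-Inv (Inv-* (Inv-det-inv (g Y)) (invDet (g X))))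
      (P.trans (P.cong₂ ℤ._+_ val-ρ³ (P.trans (val-*-Inv (Inv-det-inv (g Y)) (invDet (g X)))
                                              (P.cong (λ w → w ℤ.+ val (det (mat (g X)))) (val-det-inv (g Y)))))
               (arith (val (s X)) (val (s Y)) (val (det (mat (g X)))) (val (det (mat (g Y)))))))
    where
    ρ-Inv : Inv (s X * s⁻¹ Y)
    ρ-Inv = Inv-ratio X Y
    ρ³-Inv : Inv ((s X * s⁻¹ Y) * (s X * s⁻¹ Y) * (s X * s⁻¹ Y))
    ρ³-Inv = Inv-* (Inv-* ρ-Inv ρ-Inv) ρ-Inv
    val-ρ : val (s X * s⁻¹ Y) ≡ val (s X) ℤ.- val (s Y)
    val-ρ = P.trans (val-*-Inv (sI X) (Inv-inv (sI Y))) (P.cong (λ w → val (s X) ℤ.+ w) (val-inv (sI Y)))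
    val-ρ³ : val ((s X * s⁻¹ Y) * (s X * s⁻¹ Y) * (s X * s⁻¹ Y)) ≡
             ((val (s X) ℤ.- val (s Y)) ℤ.+ (val (s X) ℤ.- val (s Y))) ℤ.+ (val (s X) ℤ.- val (s Y))
    val-ρ³ = P.trans (val-*-Inv (Inv-* ρ-Inv ρ-Inv) ρ-Inv)
               (P.cong₂ ℤ._+_ (P.trans (val-*-Inv ρ-Inv ρ-Inv) (P.cong₂ ℤ._+_ val-ρ val-ρ)) val-ρ)
    arith : ∀ a b u v → (((a ℤ.- b) ℤ.+ (a ℤ.- b)) ℤ.+ (a ℤ.- b)) ℤ.+ (ℤ.- v ℤ.+ u) ≡
                        (((a ℤ.+ a) ℤ.+ a) ℤ.+ u) ℤ.- (((b ℤ.+ b) ℤ.+ b) ℤ.+ v)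
    arith = solve-∀

  ⊆⇒vol≥ : ∀ X Y → X ⊆ Y → vol Y ℤ.≤ vol X
  ⊆⇒vol≥ X Y h = ℤP.0≤i-j⇒j≤i (P.subst (λ w → + 0 ℤ.≤ w) (val-det-rel X Y)
                   (≤ν⇒≤val (Inv⇒Nonzero (Inv-det-rel X Y)) (≤ν-det (⊆⇒Integral X Y h))))

  rel-flip : ∀ X Y → rel Y X ≈M scal (Inv.x⁻¹ (Inv-det-rel X Y)) (adj (rel X Y))
  rel-flip X Y = left-inv-unique (≈M-trans (rel-comp X Y X) (rel-refl X)) (Inv-det-rel X Y)

  ≤ν-adj-rel⇒⊇ : ∀ X Y → (∀ i j → vol X ℤ.- vol Y ≤ν adj (rel X Y) i j) → Y ⊆ X
  ≤ν-adj-rel⇒⊇ X Y h = Integral⇒⊆ Y X (Integral-cong (≈M-sym (rel-flip X Y)) (λ i j →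
    ≤ν-reindex (ℤP.+-inverseˡ (vol X ℤ.- vol Y)) (≤ν-* det⁻¹ (h i j))))
    where
    det⁻¹ : ℤ.- (vol X ℤ.- vol Y) ≤ν Inv.x⁻¹ (Inv-det-rel X Y)
    det⁻¹ = P.subst (λ z → ℤ.- z ≤ν Inv.x⁻¹ (Inv-det-rel X Y)) (val-det-rel X Y) (≤ν-inv (Inv-det-rel X Y))

  ⊆∧vol≡⇒⊇ : ∀ X Y → X ⊆ Y → vol X ≡ vol Y → Y ⊆ X
  ⊆∧vol≡⇒⊇ X Y X⊆Y e = ≤ν-adj-rel⇒⊇ X Y (λ i j → ≤ν-reindex (P.sym vol-diff≡0) (≤ν-adj (⊆⇒Integral X Y X⊆Y) i j))
    where
    vol-diff≡0 : vol X ℤ.- vol Y ≡ + 0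
    vol-diff≡0 = P.trans (P.cong (λ w → w ℤ.- vol Y) e) (ℤP.+-inverseʳ (vol Y))

  vol<⇒⊈ : ∀ X Y → vol Y ℤ.< vol X → ¬ Y ⊆ X
  vol<⇒⊈ X Y lt h = ℤP.<-irrefl P.refl (ℤP.<-≤-trans lt (⊆⇒vol≥ Y X h))

  ⊊⇒vol< : ∀ X Y → X ⊆ Y → ¬ Y ⊆ X → vol Y ℤ.< vol X
  ⊊⇒vol< X Y h nh = ℤP.≤∧≢⇒< (⊆⇒vol≥ X Y h) (λ eq → nh (⊆∧vol≡⇒⊇ X Y h (P.sym eq)))

  _⊊_ : Lattice → Lattice → Set (c ⊔ ℓ)
  X ⊊ Y = X ⊆ Y × ¬ Y ⊆ X

  scale : (a : Carrier) → Inv a → Lattice → Lattice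
  scale a ai X = lat (a * s X) (Inv-* ai (sI X)) (g X)

  _≅_ : Lattice → Lattice → Set (c ⊔ ℓ)
  X ≅ Y = X ⊆ Y × Y ⊆ X

  ⊆-trans : ∀ X Y Z → X ⊆ Y → Y ⊆ Z → X ⊆ Z
  ⊆-trans X Y Z h1 h2 v m = h2 v (h1 v m)

  ≅-sym : ∀ X Y → X ≅ Y → Y ≅ X
  ≅-sym X Y (a , b) = b , a

  ≅-trans : ∀ X Y Z → X ≅ Y → Y ≅ Z → X ≅ Z
  ≅-trans X Y Z (a , b) (c' , d) = ⊆-trans X Y Z a c' , ⊆-trans Z Y X d b

  ≅⇒vol≡ : ∀ X Y → X ≅ Y → vol X ≡ vol Y
  ≅⇒vol≡ X Y (a , b) = ℤP.≤-antisym (⊆⇒vol≥ Y X b) (⊆⇒vol≥ X Y a)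

  rel-scale : ∀ a ai X Y → rel (scale a ai X) (scale a ai Y) ≈M rel X Y
  rel-scale a ai X Y = scal-congˡ (inv (g Y) · mat (g X))
    (trans (solve 4 (λ a b c d → (a :* b) :* (c :* d) := (a :* c) :* (b :* d)) refl a (s X) (Inv.x⁻¹ ai) (s⁻¹ Y))
           (trans (*-congʳ (Inv.x*x⁻¹ ai)) (*-identityˡ _)))

  ⊆-scale : ∀ a ai X Y → X ⊆ Y → scale a ai X ⊆ scale a ai Y
  ⊆-scale a ai X Y h = Integral⇒⊆ (scale a ai X) (scale a ai Y) (Integral-cong (≈M-sym (rel-scale a ai X Y)) (⊆⇒Integral X Y h))

  ≅-scale : ∀ a ai X Y → X ≅ Y → scale a ai X ≅ scale a ai Y
  ≅-scale a ai X Y (h1 , h2) = ⊆-scale a ai X Y h1 , ⊆-scale a ai Y X h2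

  ≤ν-rel-same-basis : ∀ σ i τ j h k l → val σ ℤ.- val τ ≤ν rel (lat σ i h) (lat τ j h) k l
  ≤ν-rel-same-basis σ i τ j h k l = ≤ν-cong (sym (scal-congʳ (σ * Inv.x⁻¹ j) (invˡ h) k l))
    (P.subst (λ w → w ≤ν σ * Inv.x⁻¹ j * I3 k l) (ℤP.+-identityʳ _) (≤ν-* val-ratio (Integral-I3 k l)))
    where
    val-ratio : val σ ℤ.- val τ ≤ν σ * Inv.x⁻¹ j
    val-ratio = ≤ν-reindex (P.trans (val-*-Inv i (Inv-inv j)) (P.cong (λ w → val σ ℤ.+ w) (val-inv j)))
                           (≤ν-val (Inv⇒Nonzero (Inv-* i (Inv-inv j))))

  ⊆-same-basis : ∀ σ i τ j h → val τ ℤ.≤ val σ → lat σ i h ⊆ lat τ j h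
  ⊆-same-basis σ i τ j h le =
    Integral⇒⊆ (lat σ i h) (lat τ j h) (λ k l → ≤ν-weaken (ℤP.i≤j⇒0≤j-i le) (≤ν-rel-same-basis σ i τ j h k l))

  ≅-same-basis : ∀ σ i τ j h → val σ ≡ val τ → lat σ i h ≅ lat τ j h
  ≅-same-basis σ i τ j h e = ⊆-same-basis σ i τ j h (ℤP.≤-reflexive (P.sym e)) , ⊆-same-basis τ j σ i h (ℤP.≤-reflexive e)

  vol-same-basis⇒val≡ : ∀ σ i τ j h → vol (lat σ i h) ≡ vol (lat τ j h) → val σ ≡ val τ
  vol-same-basis⇒val≡ σ i τ j h e = 3×-cancel (val σ) (val τ) (val (det (mat h))) e

  vol-scale : ∀ a ai X → vol (scale a ai X) ≡ ((val a ℤ.+ val a) ℤ.+ val a) ℤ.+ vol X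
  vol-scale a ai X = P.trans (P.cong (λ w → ((w ℤ.+ w) ℤ.+ w) ℤ.+ val (det (mat (g X)))) (val-*-Inv ai (sI X)))
                             (arith (val a) (val (s X)) (val (det (mat (g X)))))
    where
    arith : ∀ c s w → (((c ℤ.+ s) ℤ.+ (c ℤ.+ s)) ℤ.+ (c ℤ.+ s)) ℤ.+ w ≡ ((c ℤ.+ c) ℤ.+ c) ℤ.+ ((((s ℤ.+ s) ℤ.+ s)) ℤ.+ w)
    arith = solve-∀

  rel-⊗ʳ : ∀ X σ i h M → rel X (lat σ i (h ⊗ M)) ≈M (inv M · rel X (lat σ i h))
  rel-⊗ʳ X σ i h M = MR.begin
    scal (s X * Inv.x⁻¹ i) ((inv M · inv h) · mat (g X))
      MR.≈⟨ scal-congʳ (s X * Inv.x⁻¹ i) (·-assoc (inv M) (inv h) (mat (g X))) ⟩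
    scal (s X * Inv.x⁻¹ i) (inv M · (inv h · mat (g X))) MR.≈⟨ ≈M-sym (·-scal (s X * Inv.x⁻¹ i) (inv M) (inv h · mat (g X))) ⟩
    inv M · scal (s X * Inv.x⁻¹ i) (inv h · mat (g X)) MR.∎

  rel-⊗ˡ : ∀ σ i h M Y → rel (lat σ i (h ⊗ M)) Y ≈M (rel (lat σ i h) Y · mat M)
  rel-⊗ˡ σ i h M Y = MR.begin
    scal (σ * s⁻¹ Y) (inv (g Y) · (mat h · mat M)) MR.≈⟨ scal-congʳ (σ * s⁻¹ Y) (≈M-sym (·-assoc (inv (g Y)) (mat h) (mat M))) ⟩
    scal (σ * s⁻¹ Y) ((inv (g Y) · mat h) · mat M) MR.≈⟨ ≈M-sym (scal-· (σ * s⁻¹ Y) (inv (g Y) · mat h) (mat M)) ⟩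
    scal (σ * s⁻¹ Y) (inv (g Y) · mat h) · mat M MR.∎

  vol-⊗ : ∀ σ i h M → vol (lat σ i (h ⊗ M)) ≡ vol (lat σ i h) ℤ.+ val (det (mat M))
  vol-⊗ σ i h M = P.trans (P.cong (λ w → ((val σ ℤ.+ val σ) ℤ.+ val σ) ℤ.+ w)
                            (P.trans (val-cong (det-· (mat h) (mat M))) (val-*-Inv (invDet h) (invDet M))))
    (P.sym (ℤP.+-assoc ((val σ ℤ.+ val σ) ℤ.+ val σ) (val (det (mat h))) (val (det (mat M)))))

  rel-⊗-⊗ : ∀ σ i τ j h M M' → rel (lat σ i (h ⊗ M)) (lat τ j (h ⊗ M')) ≈M scal (σ * Inv.x⁻¹ j) (inv M' · mat M)
  rel-⊗-⊗ σ i τ j h M M' = scal-congʳ (σ * Inv.x⁻¹ j) (MR.begin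
    (inv M' · inv h) · (mat h · mat M) MR.≈⟨ ·-assoc (inv M') (inv h) (mat h · mat M) ⟩
    inv M' · (inv h · (mat h · mat M)) MR.≈⟨ ·-congˡ (inv M') (≈M-sym (·-assoc (inv h) (mat h) (mat M))) ⟩
    inv M' · ((inv h · mat h) · mat M) MR.≈⟨ ·-congˡ (inv M') (·-congʳ (mat M) (invˡ h)) ⟩
    inv M' · (I3 · mat M) MR.≈⟨ ·-congˡ (inv M') (I-· (mat M)) ⟩
    inv M' · mat M MR.∎)

  adj-rel : ∀ X Y → adj (rel X Y) ≈M scal (det (rel X Y)) (rel Y X)
  adj-rel X Y = ≈M-sym (MR.begin
    scal (det (rel X Y)) (rel Y X) MR.≈⟨ scal-congʳ (det (rel X Y)) (rel-flip X Y) ⟩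
    scal (det (rel X Y)) (scal (Inv.x⁻¹ (Inv-det-rel X Y)) (adj (rel X Y)))
      MR.≈⟨ scal-scal (det (rel X Y)) (Inv.x⁻¹ (Inv-det-rel X Y)) (adj (rel X Y)) ⟩
    scal (det (rel X Y) * Inv.x⁻¹ (Inv-det-rel X Y)) (adj (rel X Y))
      MR.≈⟨ scal-congˡ (adj (rel X Y)) (Inv.x*x⁻¹ (Inv-det-rel X Y)) ⟩
    scal 1# (adj (rel X Y)) MR.≈⟨ scal-1 (adj (rel X Y)) ⟩
    adj (rel X Y) MR.∎)

  ≅⇒~ : ∀ g h σ σI τ τI → lat σ σI g ≅ lat τ τI h → g ~ h
  ≅⇒~ g h σ σI τ τI e = Inv.x⁻¹ σI * τ , Inv⇒Nonzero (Inv-* (Inv-inv σI) τI) , ≅-trans G1 Gs Hs e0 e1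
    where
    G1 Gs Hs : Lattice
    G1 = lat 1# Inv-1# g
    Gs = scale (Inv.x⁻¹ σI) (Inv-inv σI) (lat σ σI g)
    Hs = scale (Inv.x⁻¹ σI) (Inv-inv σI) (lat τ τI h)
    e0 : G1 ≅ Gs
    e0 = ≅-same-basis 1# Inv-1# (Inv.x⁻¹ σI * σ) (Inv-* (Inv-inv σI) σI) g
           (val-cong (sym (trans (*-comm _ _) (Inv.x*x⁻¹ σI))))
    e1 : Gs ≅ Hs
    e1 = ≅-scale (Inv.x⁻¹ σI) (Inv-inv σI) (lat σ σI g) (lat τ τI h) e

  ~⇒≅ : ∀ g h → g ~ h → Σ Carrier λ α → Σ (Inv α) λ αI → lat 1# Inv-1# g ≅ lat α αI h
  ~⇒≅ g h (α , α≉0 , e) = α , mkInv α α≉0 , e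

  lift-≅ : ∀ g h σ σI {α} αI → lat 1# Inv-1# g ≅ lat α αI h → lat σ σI g ≅ lat (σ * α) (Inv-* σI αI) h
  lift-≅ g h σ σI {α} αI e =
    ≅-trans (lat σ σI g) (scale σ σI (lat 1# Inv-1# g)) (lat (σ * α) (Inv-* σI αI) h)
      (≅-same-basis σ σI (σ * 1#) (Inv-* σI Inv-1#) g (val-cong (sym (*-identityʳ σ))))
      (≅-scale σ σI (lat 1# Inv-1# g) (lat α αI h) e)

  ~-refl : ∀ g → g ~ g
  ~-refl g = 1# , 1≉0 , (λ v v∈ → v∈) , (λ v v∈ → v∈)

  ~-sym : ∀ {g h} → g ~ h → h ~ g
  ~-sym {g} {h} g~h with ~⇒≅ g h g~h
  ... | α , αI , e = ≅⇒~ h g α αI 1# Inv-1# (≅-sym (lat 1# Inv-1# g) (lat α αI h) e)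

  ~-trans : ∀ {g h k} → g ~ h → h ~ k → g ~ k
  ~-trans {g} {h} {k} g~h h~k with ~⇒≅ g h g~h | ~⇒≅ h k h~k
  ... | α , αI , e | β , βI , e′ = ≅⇒~ g k 1# Inv-1# (α * β) (Inv-* αI βI)
    (≅-trans (lat 1# Inv-1# g) (lat α αI h) (lat (α * β) (Inv-* αI βI) k) e (lift-≅ h k α αI βI e′))

  ~∧vol≡⇒≅ : ∀ g h σ σI τ τI → g ~ h → vol (lat σ σI g) ≡ vol (lat τ τI h) → lat σ σI g ≅ lat τ τI h
  ~∧vol≡⇒≅ g h σ σI τ τI g~h vol≡ with ~⇒≅ g h g~h
  ... | α , αI , e = ≅-trans (lat σ σI g) (lat (σ * α) (Inv-* σI αI) h) (lat τ τI h) σg≅σαh (≅-same-basis (σ * α) (Inv-* σI αI) τ τI h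
                       (vol-same-basis⇒val≡ (σ * α) (Inv-* σI αI) τ τI h (P.trans (P.sym (≅⇒vol≡ (lat σ σI g) (lat (σ * α) (Inv-* σI αI) h) σg≅σαh)) vol≡)))
    where
    σg≅σαh : lat σ σI g ≅ lat (σ * α) (Inv-* σI αI) h
    σg≅σαh = lift-≅ g h σ σI αI e

  ~⇒scale-≅ : ∀ g h σ σI τ τI → g ~ h → Σ Carrier λ μ → Σ (Inv μ) λ μI → scale μ μI (lat σ σI g) ≅ lat τ τI h
  ~⇒scale-≅ g h σ σI τ τI g~h with ~⇒≅ g h g~h
  ... | α , αI , e = μ , μI , ≅-trans (scale μ μI (lat σ σI g)) (lat (μ * (σ * α)) (Inv-* μI ρI) h) (lat τ τI h)
                                (≅-scale μ μI (lat σ σI g) (lat (σ * α) ρI h) (lift-≅ g h σ σI αI e))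
                                (≅-same-basis (μ * (σ * α)) (Inv-* μI ρI) τ τI h (val-cong μρ≈τ))
    where
    ρI : Inv (σ * α)
    ρI = Inv-* σI αI
    μ : Carrier
    μ = τ * Inv.x⁻¹ ρI
    μI : Inv μ
    μI = Inv-* τI (Inv-inv ρI)
    μρ≈τ : μ * (σ * α) ≈ τ
    μρ≈τ = trans (solve 3 (λ t r ρ → (t :* r) :* ρ := t :* (ρ :* r)) refl τ _ _)
                 (trans (*-congˡ (Inv.x*x⁻¹ ρI)) (*-identityʳ τ))

  scale-comm : ∀ a ai b bi X → scale a ai (scale b bi X) ≅ scale b bi (scale a ai X)
  scale-comm a ai b bi X = ≅-same-basis _ (Inv-* ai (Inv-* bi (sI X))) _ (Inv-* bi (Inv-* ai (sI X))) (g X)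
    (val-cong (solve 3 (λ a b x → a :* (b :* x) := b :* (a :* x)) refl a b (s X)))

  vol-scale-+ : ∀ μ μI X Y k → vol X ≡ vol Y ℤ.+ k → vol (scale μ μI X) ≡ vol (scale μ μI Y) ℤ.+ k
  vol-scale-+ μ μI X Y k e =
    P.trans (vol-scale μ μI X) (P.trans (P.cong (λ w → 3μ ℤ.+ w) e)
      (P.trans (P.sym (ℤP.+-assoc 3μ (vol Y) k)) (P.cong (ℤ._+ k) (P.sym (vol-scale μ μI Y)))))
    where
    3μ : ℤ
    3μ = (val μ ℤ.+ val μ) ℤ.+ val μ

  vol-π : ∀ X → vol (scale π π-Inv X) ≡ vol X ℤ.+ + 3
  vol-π X = P.trans (vol-scale π π-Inv X) (P.trans (P.cong (λ w → ((w ℤ.+ w) ℤ.+ w) ℤ.+ vol X) val-π) (ℤP.+-comm (+ 3) (vol X)))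

  chamber-vols : ∀ M₁ M₂ M₃ → scale π π-Inv M₁ ⊊ M₃ → M₃ ⊊ M₂ → M₂ ⊊ M₁ →
                 (vol M₂ ≡ vol M₁ ℤ.+ + 1) × (vol M₃ ≡ vol M₁ ℤ.+ + 2)
  chamber-vols M₁ M₂ M₃ (πM₁⊆M₃ , M₃⊈πM₁) (M₃⊆M₂ , M₂⊈M₃) (M₂⊆M₁ , M₁⊈M₂) =
    consecutive (⊊⇒vol< M₂ M₁ M₂⊆M₁ M₁⊈M₂) (⊊⇒vol< M₃ M₂ M₃⊆M₂ M₂⊈M₃)
                (P.subst (λ w → vol M₃ ℤ.< w) (vol-π M₁) (⊊⇒vol< (scale π π-Inv M₁) M₃ πM₁⊆M₃ M₃⊈πM₁))

  ≤ν-det-rel : ∀ X Y → vol X ℤ.- vol Y ≤ν det (rel X Y)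
  ≤ν-det-rel X Y = P.subst (_≤ν det (rel X Y)) (val-det-rel X Y) (≤ν-val (Inv⇒Nonzero (Inv-det-rel X Y)))

  ≤ν-adj-rel : ∀ X Y {m} → (∀ i j → m ≤ν rel Y X i j) → ∀ i j → (vol X ℤ.- vol Y) ℤ.+ m ≤ν adj (rel X Y) i j
  ≤ν-adj-rel X Y h i j = ≤ν-cong (sym (adj-rel X Y i j)) (≤ν-* (≤ν-det-rel X Y) (h i j))

  ⊆⇒≤ν-rel-π : ∀ X Y → X ⊆ Y → ∀ i j → -[1+ 0 ] ≤ν rel X (scale π π-Inv Y) i j
  ⊆⇒≤ν-rel-π X Y X⊆Y i j = ≤ν-cong (rel-comp X Y πY i j) (≤ν-· rel-Y-πY (⊆⇒Integral X Y X⊆Y) i j)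
    where
    πY : Lattice
    πY = scale π π-Inv Y
    val-s-πY : val (s Y) ℤ.- val (s πY) ≡ -[1+ 0 ]
    val-s-πY = P.trans (P.cong (λ w → val (s Y) ℤ.- w) (P.trans (val-*-Inv π-Inv (sI Y)) (P.cong (ℤ._+ val (s Y)) val-π)))
                       (arith (val (s Y)))
      where
      arith : ∀ x → x ℤ.- (+ 1 ℤ.+ x) ≡ -[1+ 0 ]
      arith = solve-∀
    rel-Y-πY : ∀ k l → -[1+ 0 ] ≤ν rel Y πY k l
    rel-Y-πY k l = ≤ν-reindex val-s-πY (≤ν-rel-same-basis (s Y) (sI Y) (s πY) (sI πY) (g Y) k l)

  ~-⊗⇒unit-integral : ∀ h M M′ → val (det (mat M)) ≡ val (det (mat M′)) → (h ⊗ M) ~ (h ⊗ M′) →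
                      Σ Carrier λ u → Unit u × Integral (scal u (inv M′ · mat M))
  ~-⊗⇒unit-integral h M M′ same-val hM~hM′ with ~⇒≅ (h ⊗ M) (h ⊗ M′) hM~hM′
  ... | α , αI , e = 1# * Inv.x⁻¹ αI , unit ,
                     Integral-cong (rel-⊗-⊗ 1# Inv-1# α αI h M M′) (⊆⇒Integral hM hM′ (proj₁ e))
    where
    hM hM′ : Lattice
    hM = lat 1# Inv-1# (h ⊗ M)
    hM′ = lat α αI (h ⊗ M′)
    vol-h≡ : vol (lat 1# Inv-1# h) ≡ vol (lat α αI h)
    vol-h≡ = +-cancelʳ-≡ (val (det (mat M))) _ _ (P.trans (P.sym (vol-⊗ 1# Inv-1# h M))
               (P.trans (≅⇒vol≡ hM hM′ e) (P.trans (vol-⊗ α αI h M′) (P.cong (λ w → vol (lat α αI h) ℤ.+ w) (P.sym same-val)))))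
    val-α : val α ≡ + 0
    val-α = P.trans (P.sym (vol-same-basis⇒val≡ 1# Inv-1# α αI h vol-h≡)) val-1#
    unit : Unit (1# * Inv.x⁻¹ αI)
    unit = val≡0⇒Unit (Inv⇒Nonzero (Inv-* Inv-1# (Inv-inv αI)))
             (P.trans (val-*-Inv Inv-1# (Inv-inv αI)) (P.cong₂ ℤ._+_ val-1# (P.trans (val-inv αI) (P.cong ℤ.-_ val-α))))

module Neighbours {c ℓ : Level} {q : ℕ} (K : NALocalField c ℓ q) where

  open import Data.Integer as ℤ using (ℤ; +_; -[1+_])
  open import Data.Sum using (_⊎_; inj₁; inj₂)
  open Lattices K public

  -- Modulo π, the lattices between π𝒪³ and 𝒪 ⊕ 𝒪 ⊕ π𝒪 of index q in the latter are the lines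
  -- of the plane spanned by e₀ and e₁: those spanned by e₀ + r e₁ give T r 𝒪³, and e₁ gives Δ 𝒪³.
  T : Carrier → Mat3
  T r zero zero = 1#
  T r (suc zero) zero = r
  T r (suc zero) (suc zero) = π
  T r (suc (suc zero)) (suc (suc zero)) = π
  T r _ _ = 0#

  T⁻¹ : Carrier → Mat3
  T⁻¹ r zero zero = 1#
  T⁻¹ r (suc zero) zero = - (r * π⁻¹)
  T⁻¹ r (suc zero) (suc zero) = π⁻¹
  T⁻¹ r (suc (suc zero)) (suc (suc zero)) = π⁻¹
  T⁻¹ r _ _ = 0#

  via-π*π⁻¹ : ∀ {x} → x ≈ π * π⁻¹ → x ≈ 1#
  via-π*π⁻¹ e = trans e π*π⁻¹≈1

  T⁻¹·T : ∀ r → (T⁻¹ r · T r) ≈M I3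
  T⁻¹·T r zero zero = solve 3 (λ r p q →
      con (+ 1) :* con (+ 1) :+ con (+ 0) :* r :+ con (+ 0) :* con (+ 0)
      := con (+ 1)) refl r π π⁻¹
  T⁻¹·T r zero (suc zero) = solve 3 (λ r p q →
      con (+ 1) :* con (+ 0) :+ con (+ 0) :* p :+ con (+ 0) :* con (+ 0)
      := con (+ 0)) refl r π π⁻¹
  T⁻¹·T r zero (suc (suc zero)) = solve 3 (λ r p q →
      con (+ 1) :* con (+ 0) :+ con (+ 0) :* con (+ 0) :+ con (+ 0) :* p
      := con (+ 0)) refl r π π⁻¹
  T⁻¹·T r (suc zero) zero = solve 3 (λ r p q →
      (:- (r :* q)) :* con (+ 1) :+ q :* r :+ con (+ 0) :* con (+ 0)
      := con (+ 0)) refl r π π⁻¹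
  T⁻¹·T r (suc zero) (suc zero) = via-π*π⁻¹ (solve 3 (λ r p q →
      (:- (r :* q)) :* con (+ 0) :+ q :* p :+ con (+ 0) :* con (+ 0)
      := p :* q) refl r π π⁻¹)
  T⁻¹·T r (suc zero) (suc (suc zero)) = solve 3 (λ r p q →
      (:- (r :* q)) :* con (+ 0) :+ q :* con (+ 0) :+ con (+ 0) :* p
      := con (+ 0)) refl r π π⁻¹
  T⁻¹·T r (suc (suc zero)) zero = solve 3 (λ r p q →
      con (+ 0) :* con (+ 1) :+ con (+ 0) :* r :+ q :* con (+ 0)
      := con (+ 0)) refl r π π⁻¹
  T⁻¹·T r (suc (suc zero)) (suc zero) = solve 3 (λ r p q →
      con (+ 0) :* con (+ 0) :+ con (+ 0) :* p :+ q :* con (+ 0)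
      := con (+ 0)) refl r π π⁻¹
  T⁻¹·T r (suc (suc zero)) (suc (suc zero)) = via-π*π⁻¹ (solve 3 (λ r p q →
      con (+ 0) :* con (+ 0) :+ con (+ 0) :* con (+ 0) :+ q :* p
      := p :* q) refl r π π⁻¹)

  T·T⁻¹ : ∀ r → (T r · T⁻¹ r) ≈M I3
  T·T⁻¹ r zero zero = solve 3 (λ r p q →
      con (+ 1) :* con (+ 1) :+ con (+ 0) :* (:- (r :* q)) :+ con (+ 0) :* con (+ 0)
      := con (+ 1)) refl r π π⁻¹
  T·T⁻¹ r zero (suc zero) = solve 3 (λ r p q →
      con (+ 1) :* con (+ 0) :+ con (+ 0) :* q :+ con (+ 0) :* con (+ 0)
      := con (+ 0)) refl r π π⁻¹
  T·T⁻¹ r zero (suc (suc zero)) = solve 3 (λ r p q →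
      con (+ 1) :* con (+ 0) :+ con (+ 0) :* con (+ 0) :+ con (+ 0) :* q
      := con (+ 0)) refl r π π⁻¹
  T·T⁻¹ r (suc zero) zero = trans (solve 3 (λ r p q →
      r :* con (+ 1) :+ p :* (:- (r :* q)) :+ con (+ 0) :* con (+ 0)
      := r :- r :* (p :* q)) refl r π π⁻¹)
    (trans (+-congˡ (-‿cong (trans (*-congˡ π*π⁻¹≈1) (*-identityʳ r)))) (-‿inverseʳ r))
  T·T⁻¹ r (suc zero) (suc zero) = via-π*π⁻¹ (solve 3 (λ r p q →
      r :* con (+ 0) :+ p :* q :+ con (+ 0) :* con (+ 0)
      := p :* q) refl r π π⁻¹)
  T·T⁻¹ r (suc zero) (suc (suc zero)) = solve 3 (λ r p q →
      r :* con (+ 0) :+ p :* con (+ 0) :+ con (+ 0) :* q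
      := con (+ 0)) refl r π π⁻¹
  T·T⁻¹ r (suc (suc zero)) zero = solve 3 (λ r p q →
      con (+ 0) :* con (+ 1) :+ con (+ 0) :* (:- (r :* q)) :+ p :* con (+ 0)
      := con (+ 0)) refl r π π⁻¹
  T·T⁻¹ r (suc (suc zero)) (suc zero) = solve 3 (λ r p q →
      con (+ 0) :* con (+ 0) :+ con (+ 0) :* q :+ p :* con (+ 0)
      := con (+ 0)) refl r π π⁻¹
  T·T⁻¹ r (suc (suc zero)) (suc (suc zero)) = via-π*π⁻¹ (solve 3 (λ r p q →
      con (+ 0) :* con (+ 0) :+ con (+ 0) :* con (+ 0) :+ p :* q
      := p :* q) refl r π π⁻¹)

  T-GL : Carrier → GL3
  T-GL r = record { mat = T r ; inv = T⁻¹ r ; invˡ = T⁻¹·T r ; invʳ = T·T⁻¹ r }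

  Δ : Mat3
  Δ zero zero = π
  Δ (suc zero) (suc zero) = 1#
  Δ (suc (suc zero)) (suc (suc zero)) = π
  Δ _ _ = 0#

  Δ⁻¹ : Mat3
  Δ⁻¹ zero zero = π⁻¹
  Δ⁻¹ (suc zero) (suc zero) = 1#
  Δ⁻¹ (suc (suc zero)) (suc (suc zero)) = π⁻¹
  Δ⁻¹ _ _ = 0#

  Δ⁻¹·Δ : (Δ⁻¹ · Δ) ≈M I3
  Δ⁻¹·Δ zero zero = via-π*π⁻¹ (solve 3 (λ r p q →
      q :* p :+ con (+ 0) :* con (+ 0) :+ con (+ 0) :* con (+ 0)
      := p :* q) refl 0# π π⁻¹)
  Δ⁻¹·Δ zero (suc zero) = solve 3 (λ r p q →
      q :* con (+ 0) :+ con (+ 0) :* con (+ 1) :+ con (+ 0) :* con (+ 0)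
      := con (+ 0)) refl 0# π π⁻¹
  Δ⁻¹·Δ zero (suc (suc zero)) = solve 3 (λ r p q →
      q :* con (+ 0) :+ con (+ 0) :* con (+ 0) :+ con (+ 0) :* p
      := con (+ 0)) refl 0# π π⁻¹
  Δ⁻¹·Δ (suc zero) zero = solve 3 (λ r p q →
      con (+ 0) :* p :+ con (+ 1) :* con (+ 0) :+ con (+ 0) :* con (+ 0)
      := con (+ 0)) refl 0# π π⁻¹
  Δ⁻¹·Δ (suc zero) (suc zero) = solve 3 (λ r p q →
      con (+ 0) :* con (+ 0) :+ con (+ 1) :* con (+ 1) :+ con (+ 0) :* con (+ 0)
      := con (+ 1)) refl 0# π π⁻¹
  Δ⁻¹·Δ (suc zero) (suc (suc zero)) = solve 3 (λ r p q →
      con (+ 0) :* con (+ 0) :+ con (+ 1) :* con (+ 0) :+ con (+ 0) :* p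
      := con (+ 0)) refl 0# π π⁻¹
  Δ⁻¹·Δ (suc (suc zero)) zero = solve 3 (λ r p q →
      con (+ 0) :* p :+ con (+ 0) :* con (+ 0) :+ q :* con (+ 0)
      := con (+ 0)) refl 0# π π⁻¹
  Δ⁻¹·Δ (suc (suc zero)) (suc zero) = solve 3 (λ r p q →
      con (+ 0) :* con (+ 0) :+ con (+ 0) :* con (+ 1) :+ q :* con (+ 0)
      := con (+ 0)) refl 0# π π⁻¹
  Δ⁻¹·Δ (suc (suc zero)) (suc (suc zero)) = via-π*π⁻¹ (solve 3 (λ r p q →
      con (+ 0) :* con (+ 0) :+ con (+ 0) :* con (+ 0) :+ q :* p
      := p :* q) refl 0# π π⁻¹)

  Δ·Δ⁻¹ : (Δ · Δ⁻¹) ≈M I3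
  Δ·Δ⁻¹ zero zero = via-π*π⁻¹ (solve 3 (λ r p q →
      p :* q :+ con (+ 0) :* con (+ 0) :+ con (+ 0) :* con (+ 0)
      := p :* q) refl 0# π π⁻¹)
  Δ·Δ⁻¹ zero (suc zero) = solve 3 (λ r p q →
      p :* con (+ 0) :+ con (+ 0) :* con (+ 1) :+ con (+ 0) :* con (+ 0)
      := con (+ 0)) refl 0# π π⁻¹
  Δ·Δ⁻¹ zero (suc (suc zero)) = solve 3 (λ r p q →
      p :* con (+ 0) :+ con (+ 0) :* con (+ 0) :+ con (+ 0) :* q
      := con (+ 0)) refl 0# π π⁻¹
  Δ·Δ⁻¹ (suc zero) zero = solve 3 (λ r p q →
      con (+ 0) :* q :+ con (+ 1) :* con (+ 0) :+ con (+ 0) :* con (+ 0)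
      := con (+ 0)) refl 0# π π⁻¹
  Δ·Δ⁻¹ (suc zero) (suc zero) = solve 3 (λ r p q →
      con (+ 0) :* con (+ 0) :+ con (+ 1) :* con (+ 1) :+ con (+ 0) :* con (+ 0)
      := con (+ 1)) refl 0# π π⁻¹
  Δ·Δ⁻¹ (suc zero) (suc (suc zero)) = solve 3 (λ r p q →
      con (+ 0) :* con (+ 0) :+ con (+ 1) :* con (+ 0) :+ con (+ 0) :* q
      := con (+ 0)) refl 0# π π⁻¹
  Δ·Δ⁻¹ (suc (suc zero)) zero = solve 3 (λ r p q →
      con (+ 0) :* q :+ con (+ 0) :* con (+ 0) :+ p :* con (+ 0)
      := con (+ 0)) refl 0# π π⁻¹
  Δ·Δ⁻¹ (suc (suc zero)) (suc zero) = solve 3 (λ r p q →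
      con (+ 0) :* con (+ 0) :+ con (+ 0) :* con (+ 1) :+ p :* con (+ 0)
      := con (+ 0)) refl 0# π π⁻¹
  Δ·Δ⁻¹ (suc (suc zero)) (suc (suc zero)) = via-π*π⁻¹ (solve 3 (λ r p q →
      con (+ 0) :* con (+ 0) :+ con (+ 0) :* con (+ 0) :+ p :* q
      := p :* q) refl 0# π π⁻¹)


  Δ-GL : GL3
  Δ-GL = record { mat = Δ ; inv = Δ⁻¹ ; invˡ = Δ⁻¹·Δ ; invʳ = Δ·Δ⁻¹ }

  det-T : ∀ r → det (T r) ≈ π * π
  det-T r = solve 2 (λ r p →
      con (+ 1) :* (p :* p :- con (+ 0) :* con (+ 0)) :- con (+ 0) :* (r :* p :- con (+ 0) :* con (+ 0)) :+ con (+ 0) :* (r :* con (+ 0) :- p :* con (+ 0))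
      := p :* p) refl r π

  det-Δ : det Δ ≈ π * π
  det-Δ = solve 1 (λ p →
      p :* (con (+ 1) :* p :- con (+ 0) :* con (+ 0)) :- con (+ 0) :* (con (+ 0) :* p :- con (+ 0) :* con (+ 0)) :+ con (+ 0) :* (con (+ 0) :* con (+ 0) :- con (+ 1) :* con (+ 0))
      := p :* p) refl π

  ≤ν-T⁻¹ : ∀ r → + 0 ≤ν r → ∀ i j → -[1+ 0 ] ≤ν T⁻¹ r i j
  ≤ν-T⁻¹ r hr zero zero = ≤ν-weaken (ℤ.-≤+) ≤ν-1#
  ≤ν-T⁻¹ r hr zero (suc zero) = ≤ν-0#
  ≤ν-T⁻¹ r hr zero (suc (suc zero)) = ≤ν-0#
  ≤ν-T⁻¹ r hr (suc zero) zero = ≤ν-neg (≤ν-* hr ≤ν-π⁻¹)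
  ≤ν-T⁻¹ r hr (suc zero) (suc zero) = ≤ν-π⁻¹
  ≤ν-T⁻¹ r hr (suc zero) (suc (suc zero)) = ≤ν-0#
  ≤ν-T⁻¹ r hr (suc (suc zero)) zero = ≤ν-0#
  ≤ν-T⁻¹ r hr (suc (suc zero)) (suc zero) = ≤ν-0#
  ≤ν-T⁻¹ r hr (suc (suc zero)) (suc (suc zero)) = ≤ν-π⁻¹

  Integral-T : ∀ r → + 0 ≤ν r → Integral (T r)
  Integral-T r hr zero zero = ≤ν-1#
  Integral-T r hr zero (suc zero) = ≤ν-0#
  Integral-T r hr zero (suc (suc zero)) = ≤ν-0#
  Integral-T r hr (suc zero) zero = hr
  Integral-T r hr (suc zero) (suc zero) = ≤ν-weaken (ℤ.+≤+ ℕ.z≤n) ≤ν-π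
  Integral-T r hr (suc zero) (suc (suc zero)) = ≤ν-0#
  Integral-T r hr (suc (suc zero)) zero = ≤ν-0#
  Integral-T r hr (suc (suc zero)) (suc zero) = ≤ν-0#
  Integral-T r hr (suc (suc zero)) (suc (suc zero)) = ≤ν-weaken (ℤ.+≤+ ℕ.z≤n) ≤ν-π

  1≤ν-T-row₂ : ∀ r k → + 1 ≤ν T r f2 k
  1≤ν-T-row₂ r zero = ≤ν-0#
  1≤ν-T-row₂ r (suc zero) = ≤ν-0#
  1≤ν-T-row₂ r (suc (suc zero)) = ≤ν-π

  Integral-Δ⁻¹· : ∀ {N} → Integral N → (∀ k → + 1 ≤ν N f0 k) → (∀ k → + 1 ≤ν N f2 k) → Integral (Δ⁻¹ · N)
  Integral-Δ⁻¹· {N} hN h0 h2 zero k = ≤ν-cong (solve 4 (λ q a b c →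
      q :* a
      := q :* a :+ con (+ 0) :* b :+ con (+ 0) :* c) refl π⁻¹ (N f0 k) (N f1 k) (N f2 k)) (≤ν-π⁻¹* (h0 k))
  Integral-Δ⁻¹· {N} hN h0 h2 (suc zero) k = ≤ν-cong (solve 3 (λ a b c →
      b
      := con (+ 0) :* a :+ con (+ 1) :* b :+ con (+ 0) :* c) refl (N f0 k) (N f1 k) (N f2 k)) (hN f1 k)
  Integral-Δ⁻¹· {N} hN h0 h2 (suc (suc zero)) k = ≤ν-cong (solve 4 (λ q a b c →
      q :* c
      := con (+ 0) :* a :+ con (+ 0) :* b :+ q :* c) refl π⁻¹ (N f0 k) (N f1 k) (N f2 k)) (≤ν-π⁻¹* (h2 k))

  Integral-T⁻¹· : ∀ {r N} → Integral N → (∀ k → + 1 ≤ν N f1 k - r * N f0 k) → (∀ k → + 1 ≤ν N f2 k) →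
                  Integral (T⁻¹ r · N)
  Integral-T⁻¹· {r} {N} hN h1 h2 = λ where
      zero             k → ≤ν-cong (e0 k) (hN f0 k)
      (suc zero)       k → ≤ν-cong (e1 k) (≤ν-π⁻¹* (h1 k))
      (suc (suc zero)) k → ≤ν-cong (e2 k) (≤ν-π⁻¹* (h2 k))
    where
    e0 : ∀ k → N f0 k ≈ (T⁻¹ r · N) f0 k
    e0 k = solve 3 (λ a b c → a := con (+ 1) :* a :+ con (+ 0) :* b :+ con (+ 0) :* c) refl (N f0 k) (N f1 k) (N f2 k)
    e1 : ∀ k → π⁻¹ * (N f1 k - r * N f0 k) ≈ (T⁻¹ r · N) f1 k
    e1 k = solve 5 (λ q r a b c → q :* (b :- r :* a) := (:- (r :* q)) :* a :+ q :* b :+ con (+ 0) :* c) refl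
             π⁻¹ r (N f0 k) (N f1 k) (N f2 k)
    e2 : ∀ k → π⁻¹ * N f2 k ≈ (T⁻¹ r · N) f2 k
    e2 k = solve 4 (λ q a b c → q :* c := con (+ 0) :* a :+ con (+ 0) :* b :+ q :* c) refl π⁻¹ (N f0 k) (N f1 k) (N f2 k)

  row₁≡r·row₀ : ∀ {N j} → Integral N → (∀ i k → + 1 ≤ν adj N i k) → (u : Unit (N f0 j)) →
                Σ (Fin q) λ t → ∀ k → + 1 ≤ν N f1 k - res t * N f0 k
  row₁≡r·row₀ {N} {j} hN hadj u with res-cover (N f1 j * Inv.x⁻¹ (Unit⇒Inv u)) (≤ν-* (hN f1 j) (≤ν-unit⁻¹ u))
  ... | t , ht = t , λ k → ≤ν-cong (sym (eq k))
          (≤ν-+ (≤ν-+ (≤ν-* (≤ν-adj⇒≤ν-cross-cols hadj j k f2) (≤ν-unit⁻¹ u)) (≤ν-* ht (hN f0 k))) (≤ν-cong (sym (z k)) ≤ν-0#))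
    where
    r u⁻¹ : Carrier
    r = res t
    u⁻¹ = Inv.x⁻¹ (Unit⇒Inv u)
    eq : ∀ k → N f1 k - r * N f0 k ≈
               ((N f0 j * N f1 k - N f1 j * N f0 k) * u⁻¹ + (N f1 j * u⁻¹ - r) * N f0 k) + N f1 k * (1# - N f0 j * u⁻¹)
    eq k = solve 6 (λ a b c d w r → d :- r :* c := ((a :* d :- b :* c) :* w :+ (b :* w :- r) :* c) :+ d :* (con (+ 1) :- a :* w)) refl
             (N f0 j) (N f1 j) (N f0 k) (N f1 k) u⁻¹ r
    z : ∀ k → N f1 k * (1# - N f0 j * u⁻¹) ≈ 0#
    z k = trans (*-congˡ (trans (+-congˡ (-‿cong (Inv.x*x⁻¹ (Unit⇒Inv u)))) (-‿inverseʳ 1#))) (zeroʳ _)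

  -- Modulo π, row 2 of N vanishes and N has rank at most one (adj N ≡ 0): either row 0 vanishes,
  -- or it has a unit entry and row 1 ≡ r · row 0 for a residue representative r.
  classify : (N : Mat3) → Integral N → (∀ k → + 1 ≤ν N f2 k) → (∀ i j → + 1 ≤ν adj N i j) →
    (Σ (Fin q) λ t → Integral (T⁻¹ (res t) · N)) ⊎ Integral (Δ⁻¹ · N)
  classify N hN h2 hadj with unit-component? (λ j → N f0 j)
  ... | inj₁ (j , u) = let t , h1 = row₁≡r·row₀ hN hadj u in inj₁ (t , Integral-T⁻¹· hN h1 h2)
  ... | inj₂ ¬unit   = inj₂ (Integral-Δ⁻¹· hN (λ k → 0≤ν∧¬Unit⇒1≤ν (hN f0 k) (¬unit k)) h2)


module AdaptedBasis {c ℓ : Level} {q : ℕ} (K : NALocalField c ℓ q) where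

  open import Data.Integer using (+_)
  open import Data.Sum using (inj₁; inj₂)
  open import Data.Empty using (⊥-elim)
  open Neighbours K public

  -- U is a change of 𝒪-basis (det U is a unit, and adj U is U⁻¹ up to this unit) after which
  -- Y𝒪³ ⊆ 𝒪 ⊕ 𝒪 ⊕ π𝒪 and P𝒪³ ⊆ π𝒪 ⊕ 𝒪 ⊕ π𝒪.
  record Adapted (Y P : Mat3) : Set (c ⊔ ℓ) where
    field
      U        : Mat3
      det-unit : Unit (det U)
      integral : Integral U
      row₂-Y   : ∀ k → + 1 ≤ν (adj U · Y) f2 k
      row₀-P   : ∀ k → + 1 ≤ν (adj U · P) f0 k
      row₂-P   : ∀ k → + 1 ≤ν (adj U · P) f2 k

  [_∣_∣_] : Vec3 → Vec3 → Vec3 → Mat3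
  [ u ∣ v ∣ w ] i zero             = u i
  [ u ∣ v ∣ w ] i (suc zero)       = v i
  [ u ∣ v ∣ w ] i (suc (suc zero)) = w i

  -- Modulo π, P has rank one (a unit entry, adj P ≡ 0) with image inside that of Y, which has rank
  -- two (adj Y ≢ 0).  The columns of U are a column y of Y not parallel to the unit column p of P,
  -- then p, then the standard basis vector completing them.
  adapted : ∀ Y P Q → Integral Y → Integral Q → P ≈M (Y · Q) → + 1 ≤ν det Y → (∀ i j → + 1 ≤ν adj P i j) →
            (∃ λ i → ∃ λ j → Unit (P i j)) → ¬ (∀ i j → + 1 ≤ν adj Y i j) → Adapted Y P
  adapted Y P Q hY hQ P≈YQ 1≤νdetY 1≤νadjP (j , c , unit) ¬1≤νadjY
    with unit-entry? (λ a m → cross (col Y a) (col P c) m)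
  ... | inj₂ ¬unit = ⊥-elim (¬1≤νadjY adj-Y≡0)
    where
    p : Vec3
    p = col P c
    hP : Integral P
    hP = Integral-cong (≈M-sym P≈YQ) (Integral-· hY hQ)
    cols-∥π : ∀ a → col Y a ∥π p
    cols-∥π a k = 0≤ν∧¬Unit⇒1≤ν (≤ν-cross (λ i → hY i a) (λ i → hP i c) k) (¬unit a k)
    cols-∥π-cols : ∀ a b → col Y a ∥π col Y b
    cols-∥π-cols a b = ∥π-trans (λ i → hY i a) (λ i → hY i b) (λ i → hP i c) unit (cols-∥π a) (cols-∥π b)
    adj-Y≡0 : ∀ i j → + 1 ≤ν adj Y i j
    adj-Y≡0 zero             = cols-∥π-cols f1 f2
    adj-Y≡0 (suc zero)       = cols-∥π-cols f2 f0
    adj-Y≡0 (suc (suc zero)) = cols-∥π-cols f0 f1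
  ... | inj₁ (a , m , unit-ym) = record
    { U = U ; det-unit = P.trans (ν-cong detU) unit-ym ; integral = integral
    ; row₂-Y = row₂-Y ; row₀-P = row₀-P ; row₂-P = row₂-P }
    where
    p y : Vec3
    p = col P c
    y = col Y a
    U : Mat3
    U = [ y ∣ p ∣ col I3 m ]
    hP : Integral P
    hP = Integral-cong (≈M-sym P≈YQ) (Integral-· hY hQ)
    detU : det U ≈ cross y p m
    detU = trans (det-triple U) (dot-e (cross y p) m)
    integral : Integral U
    integral i zero             = hY i a
    integral i (suc zero)       = hP i c
    integral i (suc (suc zero)) = Integral-I3 i m
    p≈Y·q : p ≈V mv Y (col Q c)
    p≈Y·q i = P≈YQ i c
    col≈Y·e : ∀ a → col Y a ≈V mv Y (col I3 a)
    col≈Y·e a i = sym (·-I Y i a)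
    row₂-Y : ∀ k → + 1 ≤ν (adj U · Y) f2 k
    row₂-Y k = ≤ν-cong (sym (trans (triple-cong (col≈Y·e a) p≈Y·q (col≈Y·e k)) (triple-mul Y (col I3 a) (col Q c) (col I3 k))))
                 (≤ν-* 1≤νdetY (≤ν-dot (≤ν-cross (λ i → Integral-I3 i a) (λ i → hQ i c)) (λ i → Integral-I3 i k)))
    row₀-P : ∀ k → + 1 ≤ν (adj U · P) f0 k
    row₀-P k = ≤ν-cong (sym (trans (sym (triple-cyc (col P k) p (col I3 m))) (dot-e (cross (col P k) p) m)))
                 (≤ν-adj⇒≤ν-cross-cols 1≤νadjP k c m)
    row₂-P : ∀ k → + 1 ≤ν (adj U · P) f2 k
    row₂-P k = ≤ν-cong (sym (triple-cyc y p (col P k))) (≤ν-dot (≤ν-adj⇒≤ν-cross-cols 1≤νadjP c k) (λ i → hY i a))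


module Galleries {c ℓ : Level} {q : ℕ} (K : NALocalField c ℓ q) where
  open Building K

  Continues : PointedChamber → PointedChamber → Set (c ⊔ ℓ)
  Continues c x = (v₁ x ~ v₂ c) × (v₂ x ~ v₃ c) × ¬ (v₁ c ~ v₃ x)

  module _ {n} {cs : Fin (suc n) → PointedChamber} {x : PointedChamber} where

    snoc-gallery : IsT1TaillessGallery n cs → Type1 x → Continues (cs (fromℕ n)) x →
                   IsT1TaillessGallery (suc n) (snoc cs x)
    snoc-gallery (type₁ , link₁ , link₂ , tailless) x-type₁ (x-link₁ , x-link₂ , x-tailless) =
      snoc-all Type1 cs x type₁ x-type₁ ,
      snoc-adjacent (λ c c′ → v₁ c′ ~ v₂ c) cs x link₁ x-link₁ ,
      snoc-adjacent (λ c c′ → v₂ c′ ~ v₃ c) cs x link₂ x-link₂ ,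
      snoc-adjacent (λ c c′ → ¬ (v₁ c ~ v₃ c′)) cs x tailless x-tailless

    snoc-gallery-continues : IsT1TaillessGallery (suc n) (snoc cs x) → Continues (cs (fromℕ n)) x
    snoc-gallery-continues (_ , link₁ , link₂ , tailless) =
      snoc-adjacent-last (λ c c′ → v₁ c′ ~ v₂ c) cs x link₁ ,
      snoc-adjacent-last (λ c c′ → v₂ c′ ~ v₃ c) cs x link₂ ,
      snoc-adjacent-last (λ c c′ → ¬ (v₁ c ~ v₃ c′)) cs x tailless


module Extensions {c ℓ : Level} {q : ℕ} (K : NALocalField c ℓ q) where

  open import Data.Integer as ℤ using (ℤ; +_; -[1+_])
  import Data.Integer.Properties as ℤP
  open import Data.Sum using ([_,_]′)
  open import Data.Empty using (⊥; ⊥-elim)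
  open import Function using (_∘_)
  open import Data.Integer.Tactic.RingSolver using (solve-∀)
  open AdaptedBasis K
  open IntegerArithmetic
  open Galleries K

  module OfChamber (last : PointedChamber) (a b d : Carrier) (a≉0 : Nonzero a) (b≉0 : Nonzero b) (d≉0 : Nonzero d)
    (πL₁⊊L₃ : StrictIncl (π * a) (v₁ last) d (v₃ last)) (L₃⊊L₂ : StrictIncl d (v₃ last) b (v₂ last))
    (L₂⊊L₁ : StrictIncl b (v₂ last) a (v₁ last)) where

    g₁ g₂ g₃ : GL3
    g₁ = v₁ last
    g₂ = v₂ last
    g₃ = v₃ last

    aI : Inv a
    aI = mkInv a a≉0
    bI : Inv b
    bI = mkInv b b≉0
    dI : Inv d
    dI = mkInv d d≉0

    L₁ L₂ L₃ πL₁ πL₂ : Lattice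
    L₁ = lat a aI g₁
    L₂ = lat b bI g₂
    L₃ = lat d dI g₃
    πL₁ = scale π π-Inv L₁
    πL₂ = scale π π-Inv L₂

    δ : ℤ
    δ = vol L₂

    vols : (vol L₂ ≡ vol L₁ ℤ.+ + 1) × (vol L₃ ≡ vol L₁ ℤ.+ + 2)
    vols = chamber-vols L₁ L₂ L₃ πL₁⊊L₃ L₃⊊L₂ L₂⊊L₁

    vol-L₃ : vol L₃ ≡ δ ℤ.+ + 1
    vol-L₃ = P.trans (proj₂ vols) (P.trans (e (vol L₁)) (P.cong (λ w → w ℤ.+ + 1) (P.sym (proj₁ vols))))
      where
      e : ∀ x → x ℤ.+ + 2 ≡ (x ℤ.+ + 1) ℤ.+ + 1
      e = solve-∀

    vol-πL₁ : vol πL₁ ≡ δ ℤ.+ + 2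
    vol-πL₁ = P.trans (vol-π L₁) (P.trans (e (vol L₁)) (P.cong (λ w → w ℤ.+ + 2) (P.sym (proj₁ vols))))
      where
      e : ∀ x → x ℤ.+ + 3 ≡ (x ℤ.+ + 1) ℤ.+ + 2
      e = solve-∀

    R₃ R₁ R₁₃ : Mat3
    R₃ = rel L₃ L₂
    R₁ = rel πL₁ L₂
    R₁₃ = rel πL₁ L₃

    integral-R₃ : Integral R₃
    integral-R₃ = ⊆⇒Integral L₃ L₂ (proj₁ L₃⊊L₂)

    integral-R₁ : Integral R₁
    integral-R₁ = ⊆⇒Integral πL₁ L₂ (⊆-trans πL₁ L₃ L₂ (proj₁ πL₁⊊L₃) (proj₁ L₃⊊L₂))

    val-det-R₁ : val (det R₁) ≡ + 2
    val-det-R₁ = P.trans (val-det-rel πL₁ L₂) (x≡y+k⇒x-y≡k vol-πL₁)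

    unit-entry-R₁ : ∃ λ i → ∃ λ j → Unit (R₁ i j)
    unit-entry-R₁ = [ (λ unit → unit) , (λ ¬unit → ⊥-elim (3≰2 (P.subst (+ 3 ℤ.≤_) val-det-R₁ (3≤val-det ¬unit)))) ]′
                      (unit-entry? R₁)
      where
      3≤val-det : (∀ i j → ¬ Unit (R₁ i j)) → + 3 ℤ.≤ val (det R₁)
      3≤val-det ¬unit = 1≤ν-entries⇒3≤val-det (λ i j → 0≤ν∧¬Unit⇒1≤ν (integral-R₁ i j) (¬unit i j))
                                              (Inv⇒Nonzero (Inv-det-rel πL₁ L₂))
      3≰2 : ¬ (+ 3 ℤ.≤ + 2)
      3≰2 (ℤ.+≤+ (ℕ.s≤s (ℕ.s≤s ())))

    1≤ν-adj-R₁ : ∀ i j → + 1 ≤ν adj R₁ i j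
    1≤ν-adj-R₁ i j = ≤ν-reindex (P.cong (λ w → w ℤ.+ -[1+ 0 ]) (x≡y+k⇒x-y≡k vol-πL₁))
                       (≤ν-adj-rel πL₁ L₂ (⊆⇒≤ν-rel-π L₂ L₁ (proj₁ L₂⊊L₁)) i j)

    ¬1≤ν-adj-R₃ : ¬ (∀ i j → + 1 ≤ν adj R₃ i j)
    ¬1≤ν-adj-R₃ h = proj₂ L₃⊊L₂ (≤ν-adj-rel⇒⊇ L₃ L₂ (λ i j → ≤ν-reindex (P.sym (x≡y+k⇒x-y≡k vol-L₃)) (h i j)))

    open Adapted (adapted R₃ R₁ R₁₃ integral-R₃ (⊆⇒Integral πL₁ L₃ (proj₁ πL₁⊊L₃)) (≈M-sym (rel-comp πL₁ L₃ L₂))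
                          (≤ν-reindex (x≡y+k⇒x-y≡k vol-L₃) (≤ν-det-rel L₃ L₂)) 1≤ν-adj-R₁ unit-entry-R₁ ¬1≤ν-adj-R₃)

    u⁻¹ : Carrier
    u⁻¹ = Inv.x⁻¹ (Unit⇒Inv det-unit)

    Bg : GL3
    Bg = g₂ ⊗ mkGL U (Unit⇒Inv det-unit)

    B πB : Lattice
    B = lat b bI Bg
    πB = scale π π-Inv B

    vol-B : vol B ≡ δ
    vol-B = P.trans (vol-⊗ b bI g₂ (mkGL U (Unit⇒Inv det-unit))) (P.trans (P.cong (λ w → δ ℤ.+ w) (Unit⇒val≡0 det-unit)) (ℤP.+-identityʳ δ))

    rel-B : ∀ X → rel X B ≈M scal u⁻¹ (adj U · rel X L₂)
    rel-B X = ≈M-trans (rel-⊗ʳ X b bI g₂ (mkGL U (Unit⇒Inv det-unit))) (scal-· u⁻¹ (adj U) (rel X L₂))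

    ≤ν-rel-B : ∀ X {m} i j → m ≤ν (adj U · rel X L₂) i j → m ≤ν rel X B i j
    ≤ν-rel-B X {m} i j h = ≤ν-cong (sym (rel-B X i j)) (≤ν-reindex (ℤP.+-identityˡ m) (≤ν-* (≤ν-unit⁻¹ det-unit) h))

    Z₃ Z₁ : Mat3
    Z₃ = rel L₃ B
    Z₁ = rel πL₁ B

    integral-Z₃ : Integral Z₃
    integral-Z₃ i j = ≤ν-rel-B L₃ i j (≤ν-· (≤ν-adj integral) integral-R₃ i j)

    1≤ν-Z₃-row₂ : ∀ k → + 1 ≤ν Z₃ f2 k
    1≤ν-Z₃-row₂ k = ≤ν-rel-B L₃ f2 k (row₂-Y k)

    L₂≅B : L₂ ≅ B
    L₂≅B = L₂⊆B , ⊆∧vol≡⇒⊇ L₂ B L₂⊆B (P.sym vol-B)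
      where
      L₂⊆B : L₂ ⊆ B
      L₂⊆B = Integral⇒⊆ L₂ B (λ i j → ≤ν-rel-B L₂ i j (≤ν-· (≤ν-adj integral) (Integral-cong (≈M-sym (rel-refl L₂)) Integral-I3) i j))

    W : Carrier → GL3
    W r = Bg ⊗ T-GL r

    Wᴸ : Carrier → Lattice
    Wᴸ r = lat b bI (W r)

    V∞ : Lattice
    V∞ = lat b bI (Bg ⊗ Δ-GL)

    val-π*π : val (π * π) ≡ + 2
    val-π*π = P.trans (val-*-Inv π-Inv π-Inv) (P.cong₂ ℤ._+_ val-π val-π)

    vol-W : ∀ r → vol (Wᴸ r) ≡ δ ℤ.+ + 2
    vol-W r = P.trans (vol-⊗ b bI Bg (T-GL r)) (P.cong₂ ℤ._+_ vol-B (P.trans (val-cong (det-T r)) val-π*π))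

    vol-V∞ : vol V∞ ≡ δ ℤ.+ + 2
    vol-V∞ = P.trans (vol-⊗ b bI Bg Δ-GL) (P.cong₂ ℤ._+_ vol-B (P.trans (val-cong det-Δ) val-π*π))

    πL₁≅V∞ : πL₁ ≅ V∞
    πL₁≅V∞ = πL₁⊆V∞ , ⊆∧vol≡⇒⊇ πL₁ V∞ πL₁⊆V∞ (P.trans vol-πL₁ (P.sym vol-V∞))
      where
      πL₁⊆V∞ : πL₁ ⊆ V∞
      πL₁⊆V∞ = Integral⇒⊆ πL₁ V∞ (Integral-cong (≈M-sym (rel-⊗ʳ πL₁ b bI Bg Δ-GL))
                 (Integral-Δ⁻¹· (λ i j → ≤ν-rel-B πL₁ i j (≤ν-· (≤ν-adj integral) integral-R₁ i j))
                                (λ k → ≤ν-rel-B πL₁ f0 k (row₀-P k)) (λ k → ≤ν-rel-B πL₁ f2 k (row₂-P k))))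

    module _ (r : Carrier) (r∈𝒪 : + 0 ≤ν r) where

      πL₂⊆W : πL₂ ⊆ Wᴸ r
      πL₂⊆W = ⊆-trans πL₂ πB (Wᴸ r) (proj₁ (≅-scale π π-Inv L₂ B L₂≅B))
                (Integral⇒⊆ πB (Wᴸ r) (Integral-cong (≈M-sym (rel-⊗ʳ πB b bI Bg (T-GL r)))
                  (≤ν-· (≤ν-T⁻¹ r r∈𝒪) (λ k l → ≤ν-reindex val-πb-b (≤ν-rel-same-basis (π * b) (Inv-* π-Inv bI) b bI Bg k l)))))
        where
        val-πb-b : val (π * b) ℤ.- val b ≡ + 1
        val-πb-b = x≡y+k⇒x-y≡k (P.trans (val-*-Inv π-Inv bI) (P.trans (P.cong (λ w → w ℤ.+ val b) val-π) (ℤP.+-comm (+ 1) (val b))))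

      W⊈πL₂ : ¬ Wᴸ r ⊆ πL₂
      W⊈πL₂ = vol<⇒⊈ πL₂ (Wᴸ r) (P.subst₂ ℤ._<_ (P.sym (vol-W r)) (P.sym (vol-π L₂)) (x+k<x+1+k δ 2))

      W⊆L₃ : Wᴸ r ⊆ L₃
      W⊆L₃ = Integral⇒⊆ (Wᴸ r) L₃ (Integral-cong (≈M-sym (≈M-trans (rel-⊗ˡ b bI Bg (T-GL r) L₃) (·-congʳ (T r) (rel-flip L₃ B)))) entries)
        where
        det⁻¹ : -[1+ 0 ] ≤ν Inv.x⁻¹ (Inv-det-rel L₃ B)
        det⁻¹ = P.subst (λ w → ℤ.- w ≤ν Inv.x⁻¹ (Inv-det-rel L₃ B))
                  (P.trans (val-det-rel L₃ B) (x≡y+k⇒x-y≡k (P.trans vol-L₃ (P.cong (λ w → w ℤ.+ + 1) (P.sym vol-B)))))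
                  (≤ν-inv (Inv-det-rel L₃ B))
        adj-cols : ∀ i → + 1 ≤ν adj Z₃ i f0 × + 1 ≤ν adj Z₃ i f1
        adj-cols = 1≤ν-row₂⇒1≤ν-adj-cols₀₁ integral-Z₃ 1≤ν-Z₃-row₂
        entries : Integral (scal (Inv.x⁻¹ (Inv-det-rel L₃ B)) (adj Z₃) · T r)
        entries i k = ≤ν-+ (≤ν-+ (≤ν-* (≤ν-* det⁻¹ (proj₁ (adj-cols i))) (Integral-T r r∈𝒪 f0 k))
                                 (≤ν-* (≤ν-* det⁻¹ (proj₂ (adj-cols i))) (Integral-T r r∈𝒪 f1 k)))
                           (≤ν-* (≤ν-* det⁻¹ (≤ν-adj integral-Z₃ i f2)) (1≤ν-T-row₂ r k))

      L₃⊈W : ¬ L₃ ⊆ Wᴸ r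
      L₃⊈W = vol<⇒⊈ (Wᴸ r) L₃ (P.subst₂ ℤ._<_ (P.sym vol-L₃) (P.sym (vol-W r)) (x+k<x+1+k δ 1))

      typeStep : TypeStep g₃ (W r)
      typeStep = val (det (mat g₃)) , val (det (mat (W r))) , val d ℤ.- val b ,
                 ν≡fin-val (Inv⇒Nonzero (invDet g₃)) , ν≡fin-val (Inv⇒Nonzero (invDet (W r))) ,
                 arith (val b) (val d) (val (det (mat (W r)))) (val (det (mat g₃)))
                       (P.trans (vol-W r) (P.trans (e δ) (P.cong (λ w → w ℤ.+ + 1) (P.sym vol-L₃))))
        where
        e : ∀ x → x ℤ.+ + 2 ≡ (x ℤ.+ + 1) ℤ.+ + 1
        e = solve-∀
        arith : ∀ vb vd w z → ((vb ℤ.+ vb) ℤ.+ vb) ℤ.+ w ≡ (((vd ℤ.+ vd) ℤ.+ vd) ℤ.+ z) ℤ.+ + 1 →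
                w ℤ.- z ≡ + 1 ℤ.+ + 3 ℤ.* (vd ℤ.- vb)
        arith vb vd w z e′ = P.trans (P.cong (ℤ._- z) (P.trans (l1 vb w) (P.cong (ℤ._- ((vb ℤ.+ vb) ℤ.+ vb)) e′))) (l2 vb vd z)
          where
          l1 : ∀ vb w → w ≡ (((vb ℤ.+ vb) ℤ.+ vb) ℤ.+ w) ℤ.- ((vb ℤ.+ vb) ℤ.+ vb)
          l1 = solve-∀
          l2 : ∀ vb vd z → ((((vd ℤ.+ vd) ℤ.+ vd) ℤ.+ z) ℤ.+ + 1) ℤ.- ((vb ℤ.+ vb) ℤ.+ vb) ℤ.- z ≡ + 1 ℤ.+ + 3 ℤ.* (vd ℤ.- vb)
          l2 = solve-∀

    -- g₁ is the class of πL₁ = B · Δ, and B · Δ ~ B · T r would make the entry π⁻¹ of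
    -- (T r)⁻¹ Δ integral up to a unit.
    g₁≁W : ∀ r → ¬ (g₁ ~ W r)
    g₁≁W r g₁~W = 0≰-1 (P.subst (+ 0 ℤ.≤_) val-uπ⁻¹ (≤ν⇒≤val (Inv⇒Nonzero uπ⁻¹-Inv) (≤ν-cong (*-congˡ entry) (integral-uT⁻¹Δ f1 f1))))
      where
      g₁~Δ : g₁ ~ (Bg ⊗ Δ-GL)
      g₁~Δ = ≅⇒~ g₁ (Bg ⊗ Δ-GL) (π * a) (Inv-* π-Inv aI) b bI πL₁≅V∞
      unit-integral : Σ Carrier λ u → Unit u × Integral (scal u (T⁻¹ r · Δ))
      unit-integral = ~-⊗⇒unit-integral Bg Δ-GL (T-GL r) (P.trans (val-cong det-Δ) (P.sym (val-cong (det-T r))))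
                                         (~-trans {Bg ⊗ Δ-GL} {g₁} {W r} (~-sym {g₁} {Bg ⊗ Δ-GL} g₁~Δ) g₁~W)
      u : Carrier
      u = proj₁ unit-integral
      unit : Unit u
      unit = proj₁ (proj₂ unit-integral)
      integral-uT⁻¹Δ : Integral (scal u (T⁻¹ r · Δ))
      integral-uT⁻¹Δ = proj₂ (proj₂ unit-integral)
      entry : (T⁻¹ r · Δ) f1 f1 ≈ π⁻¹
      entry = solve 2 (λ r q → (:- (r :* q)) :* con (+ 0) :+ q :* con (+ 1) :+ con (+ 0) :* con (+ 0) := q) refl r π⁻¹
      uπ⁻¹-Inv : Inv (u * π⁻¹)
      uπ⁻¹-Inv = Inv-* (Unit⇒Inv unit) (Inv-inv π-Inv)
      val-uπ⁻¹ : val (u * π⁻¹) ≡ -[1+ 0 ]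
      val-uπ⁻¹ = P.trans (val-*-Inv (Unit⇒Inv unit) (Inv-inv π-Inv))
                         (P.cong₂ ℤ._+_ (Unit⇒val≡0 unit) (P.trans (val-inv π-Inv) (P.cong ℤ.-_ val-π)))
      0≰-1 : ¬ (+ 0 ℤ.≤ -[1+ 0 ])
      0≰-1 ()

    W-injective : ∀ s t → W (res s) ~ W (res t) → s ≡ t
    W-injective s t W~W = res-inj s t (≤ν-cong π[π⁻¹x]≈x (≤ν-* ≤ν-π (≤ν-unit-cancel unit (≤ν-cong (*-congˡ entry) (integral-uT⁻¹T f1 f0)))))
      where
      rₛ rₜ : Carrier
      rₛ = res s
      rₜ = res t
      unit-integral : Σ Carrier λ u → Unit u × Integral (scal u (T⁻¹ rₜ · T rₛ))
      unit-integral = ~-⊗⇒unit-integral Bg (T-GL rₛ) (T-GL rₜ) (P.trans (val-cong (det-T rₛ)) (P.sym (val-cong (det-T rₜ)))) W~W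
      u : Carrier
      u = proj₁ unit-integral
      unit : Unit u
      unit = proj₁ (proj₂ unit-integral)
      integral-uT⁻¹T : Integral (scal u (T⁻¹ rₜ · T rₛ))
      integral-uT⁻¹T = proj₂ (proj₂ unit-integral)
      entry : (T⁻¹ rₜ · T rₛ) f1 f0 ≈ π⁻¹ * (rₛ - rₜ)
      entry = solve 3 (λ r t q → (:- (t :* q)) :* con (+ 1) :+ q :* r :+ con (+ 0) :* con (+ 0) := q :* (r :- t)) refl rₛ rₜ π⁻¹
      π[π⁻¹x]≈x : π * (π⁻¹ * (rₛ - rₜ)) ≈ rₛ - rₜ
      π[π⁻¹x]≈x = trans (sym (*-assoc π π⁻¹ _)) (trans (*-congʳ π*π⁻¹≈1) (*-identityˡ _))

    extension : Fin q → PointedChamber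
    extension t = record
      { v₁ = g₂ ; v₂ = g₃ ; v₃ = W (res t)
      ; chamber = b , d , b , b≉0 , d≉0 , b≉0 ,
                  (πL₂⊆W (res t) (res-int t) , W⊈πL₂ (res t) (res-int t)) ,
                  (W⊆L₃ (res t) (res-int t) , L₃⊈W (res t) (res-int t)) , L₃⊊L₂ }

    extension-type1 : TypeStep g₂ g₃ → ∀ t → Type1 (extension t)
    extension-type1 step t = step , typeStep (res t) (res-int t)

    extension-continues : ∀ t → Continues last (extension t)
    extension-continues t = ~-refl g₂ , ~-refl g₃ , g₁≁W (res t)

    extension-injective : ∀ s t → extension s ≃PC extension t → s ≡ t
    extension-injective s t (_ , _ , W~W) = W-injective s t W~W

    -- μ rescales the new chamber so that its first lattice is L₂; its third lattice W′ then lies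
    -- between πL₂ and L₃, hence is one of the q + 1 lattices B · T r and B · Δ = πL₁.
    module Completeness (x : PointedChamber) (A A′ A″ : Carrier) (A≉0 : Nonzero A) (A′≉0 : Nonzero A′) (A″≉0 : Nonzero A″)
      (πM₁⊊M₃ : StrictIncl (π * A) (v₁ x) A″ (v₃ x)) (M₃⊊M₂ : StrictIncl A″ (v₃ x) A′ (v₂ x))
      (M₂⊊M₁ : StrictIncl A′ (v₂ x) A (v₁ x)) (x₁~g₂ : v₁ x ~ g₂) (x₂~g₃ : v₂ x ~ g₃) (g₁≁x₃ : ¬ (g₁ ~ v₃ x)) where

      M₁ M₂ M₃ : Lattice
      M₁ = lat A (mkInv A A≉0) (v₁ x)
      M₂ = lat A′ (mkInv A′ A′≉0) (v₂ x)
      M₃ = lat A″ (mkInv A″ A″≉0) (v₃ x)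

      μ : Carrier
      μ = proj₁ (~⇒scale-≅ (v₁ x) g₂ A (mkInv A A≉0) b bI x₁~g₂)

      μI : Inv μ
      μI = proj₁ (proj₂ (~⇒scale-≅ (v₁ x) g₂ A (mkInv A A≉0) b bI x₁~g₂))

      μM₁≅L₂ : scale μ μI M₁ ≅ L₂
      μM₁≅L₂ = proj₂ (proj₂ (~⇒scale-≅ (v₁ x) g₂ A (mkInv A A≉0) b bI x₁~g₂))

      vol-μM₁ : vol (scale μ μI M₁) ≡ δ
      vol-μM₁ = ≅⇒vol≡ (scale μ μI M₁) L₂ μM₁≅L₂

      W′ : Lattice
      W′ = scale μ μI M₃

      vol-W′ : vol W′ ≡ δ ℤ.+ + 2
      vol-W′ = P.trans (vol-scale-+ μ μI M₃ M₁ (+ 2) (proj₂ (chamber-vols M₁ M₂ M₃ πM₁⊊M₃ M₃⊊M₂ M₂⊊M₁)))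
                       (P.cong (λ w → w ℤ.+ + 2) vol-μM₁)

      μM₂≅L₃ : scale μ μI M₂ ≅ L₃
      μM₂≅L₃ = ~∧vol≡⇒≅ (v₂ x) g₃ (μ * A′) (Inv-* μI (mkInv A′ A′≉0)) d dI x₂~g₃
                 (P.trans (vol-scale-+ μ μI M₂ M₁ (+ 1) (proj₁ (chamber-vols M₁ M₂ M₃ πM₁⊊M₃ M₃⊊M₂ M₂⊊M₁)))
                          (P.trans (P.cong (λ w → w ℤ.+ + 1) vol-μM₁) (P.sym vol-L₃)))

      W′⊆L₃ : W′ ⊆ L₃
      W′⊆L₃ = ⊆-trans W′ (scale μ μI M₂) L₃ (⊆-scale μ μI M₃ M₂ (proj₁ M₃⊊M₂)) (proj₁ μM₂≅L₃)

      πL₂⊆W′ : πL₂ ⊆ W′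
      πL₂⊆W′ = ⊆-trans πL₂ (scale π π-Inv (scale μ μI M₁)) W′
                 (proj₂ (≅-scale π π-Inv (scale μ μI M₁) L₂ μM₁≅L₂))
                 (⊆-trans (scale π π-Inv (scale μ μI M₁)) (scale μ μI (scale π π-Inv M₁)) W′
                    (proj₁ (scale-comm π π-Inv μ μI M₁)) (⊆-scale μ μI (scale π π-Inv M₁) M₃ (proj₁ πM₁⊊M₃)))

      N : Mat3
      N = rel W′ B

      integral-rel-W′-L₃ : Integral (rel W′ L₃)
      integral-rel-W′-L₃ = ⊆⇒Integral W′ L₃ W′⊆L₃

      integral-N : Integral N
      integral-N = Integral-cong (rel-comp W′ L₃ B) (Integral-· integral-Z₃ integral-rel-W′-L₃)

      1≤ν-N-row₂ : ∀ k → + 1 ≤ν N f2 k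
      1≤ν-N-row₂ k = ≤ν-cong (rel-comp W′ L₃ B f2 k)
        (≤ν-sum3 (λ l → ≤ν-reindex (ℤP.+-identityʳ (+ 1)) (≤ν-* (1≤ν-Z₃-row₂ l) (integral-rel-W′-L₃ l k))))

      1≤ν-adj-N : ∀ i j → + 1 ≤ν adj N i j
      1≤ν-adj-N i j = ≤ν-reindex (P.cong (λ w → w ℤ.+ -[1+ 0 ]) (x≡y+k⇒x-y≡k (P.trans vol-W′ (P.cong (λ w → w ℤ.+ + 2) (P.sym vol-B)))))
        (≤ν-adj-rel W′ B (λ k l → ≤ν-cong (rel-comp B πL₂ W′ k l)
          (≤ν-· (⊆⇒Integral πL₂ W′ πL₂⊆W′) (⊆⇒≤ν-rel-π B L₂ (proj₂ L₂≅B)) k l)) i j)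

      x₃~W : Σ (Fin q) λ t → v₃ x ~ W (res t)
      x₃~W = [ in-some-W , ⊥-elim ∘ in-V∞ ]′ (classify N integral-N 1≤ν-N-row₂ 1≤ν-adj-N)
        where
        in-some-W : (Σ (Fin q) λ t → Integral (T⁻¹ (res t) · N)) → Σ (Fin q) λ t → v₃ x ~ W (res t)
        in-some-W (t , integral-T⁻¹N) = t , ≅⇒~ (v₃ x) (W (res t)) (s W′) (sI W′) b bI
            (W′⊆W , ⊆∧vol≡⇒⊇ W′ (Wᴸ (res t)) W′⊆W (P.trans vol-W′ (P.sym (vol-W (res t)))))
          where
          W′⊆W : W′ ⊆ Wᴸ (res t)
          W′⊆W = Integral⇒⊆ W′ (Wᴸ (res t)) (Integral-cong (≈M-sym (rel-⊗ʳ W′ b bI Bg (T-GL (res t)))) integral-T⁻¹N)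
        in-V∞ : Integral (Δ⁻¹ · N) → ⊥
        in-V∞ integral-Δ⁻¹N = g₁≁x₃ (≅⇒~ g₁ (v₃ x) (π * a) (Inv-* π-Inv aI) (s W′) (sI W′)
            (≅-trans πL₁ V∞ W′ πL₁≅V∞ (≅-sym W′ V∞ (W′⊆V∞ , ⊆∧vol≡⇒⊇ W′ V∞ W′⊆V∞ (P.trans vol-W′ (P.sym vol-V∞))))))
          where
          W′⊆V∞ : W′ ⊆ V∞
          W′⊆V∞ = Integral⇒⊆ W′ V∞ (Integral-cong (≈M-sym (rel-⊗ʳ W′ b bI Bg Δ-GL)) integral-Δ⁻¹N)

    extension-complete : ∀ x → Continues last x → ∃ λ t → x ≃PC extension t
    extension-complete x (x₁~g₂ , x₂~g₃ , g₁≁x₃) = from-chamber (PointedChamber.chamber x)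
      where
      from-chamber : IsChamber (v₁ x) (v₂ x) (v₃ x) → ∃ λ t → x ≃PC extension t
      from-chamber (A , A′ , A″ , A≉0 , A′≉0 , A″≉0 , πM₁⊊M₃ , M₃⊊M₂ , M₂⊊M₁) = proj₁ x₃~W , x₁~g₂ , x₂~g₃ , proj₂ x₃~W
        where
        x₃~W : Σ (Fin q) λ t → v₃ x ~ W (res t)
        x₃~W = Completeness.x₃~W x A A′ A″ A≉0 A′≉0 A″≉0 πM₁⊊M₃ M₃⊊M₂ M₂⊊M₁ x₁~g₂ x₂~g₃ g₁≁x₃


mainTheorem7 : ∀ {c ℓ : Level} (q : ℕ) (K : NALocalField c ℓ q) →
  let open Building K in
  (n : ℕ) (cs : Fin (suc n) → PointedChamber) →
  IsT1TaillessGallery n cs →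
  Σ (Fin q → PointedChamber) λ ext →
    (∀ i → IsT1TaillessGallery (suc n) (snoc cs (ext i))) ×
    (∀ i j → ext i ≃PC ext j → i ≡ j) ×
    (∀ d → IsT1TaillessGallery (suc n) (snoc cs d) → ∃ λ i → d ≃PC ext i)
mainTheorem7 q K n cs gal with Building.chamber (cs (fromℕ n))
... | a , b , d , a≉0 , b≉0 , d≉0 , πL₁⊊L₃ , L₃⊊L₂ , L₂⊊L₁ =
  extension ,
  (λ t → snoc-gallery gal (extension-type1 (proj₂ (proj₁ gal (fromℕ n))) t) (extension-continues t)) ,
  extension-injective ,
  (λ x x-gallery → extension-complete x (snoc-gallery-continues x-gallery))
  where
  open Galleries K
  open Extensions.OfChamber K (cs (fromℕ n)) a b d a≉0 b≉0 d≉0 πL₁⊊L₃ L₃⊊L₂ L₂⊊L₁
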